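{- Let $\mathbb{H}$ be a gehm. If $\mathbb{H}$ has no hyperedges then $Z(\mathbb{H};u,v)=v^{f(\mathbb{H})}$. Otherwise, for each hyperedge $e$ of $\mathbb{H}$, \[Z(\mathbb{H};u,v)=Z(\mathbb{H}\setminus e;u,v)+u^{d(e)-1}Z(\mathbb{H}/ e;u,v).\]
   Context: A gehm is a finite cubic graph whose edges are properly coloured with colours $b,g,r$, together with possibly some isolates ($g$-coloured edges meeting no vertex, i.e. closed circles). A hyperedge is a $b$--$r$-cycle; a hyperface is a $b$--$g$-cycle or an isolate. $E(\mathbb{H})$ is the set of hyperedges, $f(\mathbb{H})$ the number of hyperfaces, $d(e)$ is half the number of gehm-edges in the cycle $e$, and for $A\subseteq E(\mathbb{H})$, $d(A)=\sum_{e\in A}d(e)$. Suppressing a degree-two vertex $v$: if the only edge at $v$ is a loop, replace $v$ and the loop by an isolate; otherwise contract one edge at $v$. $\mathbb{H}\setminus e$: delete the $b$-edges of $e$, contract the $r$-edges of $e$, suppress degree-two vertices. $\mathbb{H}/ e$: delete the $r$-edges of $e$, contract the $b$-edges of $e$, suppress degree-two vertices. For $A\subseteq E(\mathbb{H})$, $\mathbb{H}_{|A}$ is obtained by deleting all hyperedges not in $A$, and $f(A)=f(\mathbb{H}_{|A})$. The dichromatic polynomial is $Z(\mathbb{H};u,v)=\sum_{A\subseteq E(\mathbb{H})}u^{d(A)-|A|}v^{f(A)}$. -}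

module Defs where

open import Data.Bool using (Bool; true; false; if_then_else_; _∧_; not)
open import Data.Nat as ℕ using (ℕ; zero; suc; _∸_; _≤ᵇ_; _≡ᵇ_; _/_)
open import Data.Integer as ℤ using (ℤ)
open import Data.List using (List; []; _∷_; map; length; concat; foldr; _++_)
open import Data.Bool.ListAction using (any; all)
open import Data.List.Membership.Propositional using (_∈_)
open import Data.List.Relation.Unary.Unique.Propositional using (Unique)
open import Data.Product using (_×_; _,_)
open import Relation.Binary.PropositionalEquality using (_≡_; _≢_)

-- Raw gehm data.  Vertices are distinct natural-number labels; each
-- colour c ∈ {b,g,r} is given by the map v ↦ (other end of the
-- c-coloured edge at v).  'isolates' counts the isolates.

record Gehm : Set where
  field
    verts    : List ℕ
    b g r    : ℕ → ℕ
    isolates : ℕ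
open Gehm public

IsMatching : List ℕ → (ℕ → ℕ) → Set
IsMatching V c = ∀ v → v ∈ V → (c v ∈ V) × (c (c v) ≡ v) × (c v ≢ v)

-- H is a gehm: finite cubic graph with a proper b,g,r edge colouring
-- (plus isolates).
IsGehm : Gehm → Set
IsGehm H = Unique (verts H) × IsMatching (verts H) (b H)
         × IsMatching (verts H) (g H) × IsMatching (verts H) (r H)

elem : ℕ → List ℕ → Bool
elem x = any (x ≡ᵇ_)

walk : (ℕ → ℕ) → (ℕ → ℕ) → ℕ → ℕ → List ℕ
walk f h zero    v = []
walk f h (suc k) v = v ∷ walk h f k (f v)

filterB : (ℕ → Bool) → List ℕ → List ℕ
filterB p []       = []
filterB p (x ∷ xs) = if p x then x ∷ filterB p xs else filterB p xs

-- vertex set of the bicoloured (f,h)-cycle through w, listed in the order of V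
cyc : List ℕ → (ℕ → ℕ) → (ℕ → ℕ) → ℕ → List ℕ
cyc V f h w = filterB (λ z → elem z (walk f h (length V) w)) V

isMin : ℕ → List ℕ → Bool
isMin w = all (w ≤ᵇ_)

-- number of (f,h)-bicoloured cycles of V, counted by their least vertex
#cycles : List ℕ → (ℕ → ℕ) → (ℕ → ℕ) → ℕ
#cycles V f h = length (filterB (λ w → isMin w (cyc V f h w)) V)

-- Hyperedges (b-r cycles, given by their vertex sets) and hyperfaces

Hyperedge : Set
Hyperedge = List ℕ

hyperedges : Gehm → List Hyperedge
hyperedges H = map (cyc V (b H) (r H)) (filterB (λ w → isMin w (cyc V (b H) (r H) w)) V)
  where
  V = verts H

f : Gehm → ℕ
f H = #cycles (verts H) (b H) (g H) ℕ.+ isolates H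

-- d(e): half the number of gehm-edges of the cycle e (= half its vertex count)
d : Hyperedge → ℕ
d e = length e / 2

dSet : List Hyperedge → ℕ
dSet A = foldr (λ e n → d e ℕ.+ n) 0 A

-- Removing a set S of vertices (a union of hyperedges) where the
-- c-edges inside S are contracted and the other hyperedge colour is
-- deleted, followed by suppression of all degree-two vertices.
--   c = r : deletion  H ∖ e   (delete b-edges, contract r-edges)
--   c = b : contraction H / e (delete r-edges, contract b-edges)
-- Each merged vertex {y, c y} (y ∈ S) is left with its two g-edges;
-- suppressing it joins these two g-edges.  Hence the new g-edge at a
-- surviving vertex x runs x, g x, g (c (g x)), … until it leaves S,
-- and every g-c cycle lying entirely inside S becomes a closed
-- g-circle, i.e. an isolate.

follow : List ℕ → (ℕ → ℕ) → (ℕ → ℕ) → ℕ → ℕ → ℕ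
follow S gg c zero    y = y
follow S gg c (suc k) y = if elem y S then follow S gg c k (gg (c y)) else y

#innerCycles : List ℕ → List ℕ → (ℕ → ℕ) → (ℕ → ℕ) → ℕ
#innerCycles V S gg c =
  length (filterB (λ w → elem w S ∧ isMin w (cyc V gg c w)
                           ∧ all (λ z → elem z S) (cyc V gg c w)) V)

remove : Gehm → List ℕ → (ℕ → ℕ) → Gehm
remove H S c = record
  { verts    = filterB (λ v → not (elem v S)) (verts H)
  ; b        = b H
  ; g        = λ x → follow S (g H) c (length (verts H)) (g H x)
  ; r        = r H
  ; isolates = isolates H ℕ.+ #innerCycles (verts H) S (g H) c
  }

_∖_ : Gehm → Hyperedge → Gehm
H ∖ e = remove H e (r H)

_／_ : Gehm → Hyperedge → Gehm
H ／ e = remove H e (b H)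

-- H_{|A}: delete all hyperedges not in A (C is the list of those).
-- Deleting them one at a time in any order gives the same result.
restrictTo : Gehm → List Hyperedge → Gehm
restrictTo H C = remove H (concat C) (r H)

splits : List Hyperedge → List (List Hyperedge × List Hyperedge)
splits []       = ([] , []) ∷ []
splits (x ∷ xs) = map (λ { (a , c) → (x ∷ a , c) }) (splits xs)
               ++ map (λ { (a , c) → (a , x ∷ c) }) (splits xs)

sumℤ : List ℤ → ℤ
sumℤ = foldr ℤ._+_ (ℤ.+ 0)

Z : Gehm → ℤ → ℤ → ℤ
Z H u v = sumℤ (map (λ { (A , C) → (u ℤ.^ (dSet A ∸ length A)) ℤ.* (v ℤ.^ f (restrictTo H C)) })
                    (splits (hyperedges H)))

-- Write φ_A for the perfect matching that is b on the hyperedges in A and r on the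
-- others.  Deleting the hyperedges outside A contracts their r-edges; suppressing the
-- resulting degree-two vertices turns every (φ_A, g)-cycle through a surviving vertex into
-- one hyperface, and every (φ_A, g)-cycle inside the deleted vertices into an isolate.  So
-- f(A) is the number of (φ_A, g)-cycles plus the isolates of H, and the same count shows
-- that deleting (contracting) e and then restricting to A agrees with restricting H to A
-- (to A ∪ {e}).  Since E(H ∖ e) = E(H / e) = E(H) ∖ {e}, splitting the sum defining Z by
-- whether e ∈ A gives the recurrence, with d(A ∪ {e}) - |A ∪ {e}| = (d(e) - 1) + (d(A) - |A|).

module Submission where

open import Defs
open import Data.Bool using (Bool; true; false; if_then_else_; _∧_; _∨_; not; T)
open import Data.Bool.ListAction using (all)
open import Data.Bool.Properties using (∧-zeroʳ; ∧-identityʳ; ∧-comm; not-involutive; ¬-not; ⇔→≡)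
open import Data.Empty using (⊥-elim)
open import Data.Fin using (Fin; toℕ)
import Data.Fin.Properties as Finₚ
open import Data.Integer as ℤ using (ℤ; _+_; _*_; _^_)
import Data.Integer.Properties as ℤₚ
open import Data.List using (List; []; _∷_; length; _++_; map; concat; lookup)
import Data.List.Properties as Listₚ
open import Data.List.Membership.Propositional using (_∈_)
import Data.List.Membership.Propositional.Properties as ∈ₚ
open import Data.List.Relation.Binary.Subset.Propositional using (_⊆_)
open import Data.List.Relation.Unary.All as All using ()
open import Data.List.Relation.Unary.AllPairs using ([]; _∷_)
open import Data.List.Relation.Unary.Any as Any using (here; there)
import Data.List.Relation.Unary.Any.Properties as Anyₚ
open import Data.List.Relation.Unary.Unique.Propositional using (Unique)
open import Data.Nat as ℕ using (ℕ; zero; suc; _∸_; _≤_; _<_; _≡ᵇ_; _≤ᵇ_; z≤n; s≤s)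
open import Data.Nat.DivMod using (m≥n⇒m/n>0)
import Data.Nat.Properties as ℕₚ
open import Data.Product using (Σ; _×_; _,_; proj₁; proj₂)
open import Data.Sum using (_⊎_; inj₁; inj₂; [_,_])
open import Function.Bundles using (mk⇔)
open import Relation.Binary.Definitions using (tri<; tri≈; tri>)
open import Relation.Binary.PropositionalEquality
  using (_≡_; _≢_; refl; sym; trans; cong; cong₂; subst; module ≡-Reasoning)
open import Relation.Nullary using (yes; no)
open import Algebra.Properties.CommutativeSemigroup ℕₚ.+-commutativeSemigroup using (x∙yz≈y∙xz)
open import Algebra.Properties.CommutativeSemigroup ℤₚ.+-commutativeSemigroup using (interchange)

-- Boolean membership and filtering

_∈ᵇ_ : ℕ → List ℕ → Set
x ∈ᵇ L = elem x L ≡ true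

_∉ᵇ_ : ℕ → List ℕ → Set
x ∉ᵇ L = elem x L ≡ false

SameElems : List ℕ → List ℕ → Set
SameElems A B = ∀ y → elem y A ≡ elem y B

true⇒T : ∀ {b} → b ≡ true → T b
true⇒T refl = _

T⇒true : ∀ {b} → T b → b ≡ true
T⇒true {true} _ = refl

false≢true : false ≢ true
false≢true ()

≡-by-true : ∀ {a b} → (a ≡ true → b ≡ true) → (b ≡ true → a ≡ true) → a ≡ b
≡-by-true p q = ⇔→≡ (mk⇔ p q)

∨-true⁻ : ∀ a {b} → (a ∨ b) ≡ true → a ≡ true ⊎ b ≡ true
∨-true⁻ true  e = inj₁ refl
∨-true⁻ false e = inj₂ e

∨-trueʳ : ∀ a {b} → b ≡ true → (a ∨ b) ≡ true
∨-trueʳ true  e = refl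
∨-trueʳ false e = e

∧-true⁻ : ∀ {a b} → (a ∧ b) ≡ true → a ≡ true × b ≡ true
∧-true⁻ {true} {true} e = refl , refl

∧-true⁺ : ∀ {a b} → a ≡ true → b ≡ true → (a ∧ b) ≡ true
∧-true⁺ refl refl = refl

elem⇒∈ : ∀ {x} L → x ∈ᵇ L → x ∈ L
elem⇒∈ {x} (y ∷ L) e with ∨-true⁻ (x ≡ᵇ y) e
... | inj₁ p = here (ℕₚ.≡ᵇ⇒≡ x y (true⇒T p))
... | inj₂ p = there (elem⇒∈ L p)

≡ᵇ-refl : ∀ m → (m ≡ᵇ m) ≡ true
≡ᵇ-refl m = T⇒true (ℕₚ.≡⇒≡ᵇ m m refl)

∈⇒elem : ∀ {x L} → x ∈ L → x ∈ᵇ L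
∈⇒elem {x} (here refl) rewrite ≡ᵇ-refl x = refl
∈⇒elem {x} {y ∷ L} (there p) = ∨-trueʳ (x ≡ᵇ y) (∈⇒elem p)

elem-++ : ∀ x (A B : List ℕ) → elem x (A ++ B) ≡ (elem x A ∨ elem x B)
elem-++ x []      B = refl
elem-++ x (y ∷ A) B rewrite elem-++ x A B with x ≡ᵇ y
... | true  = refl
... | false = refl

count : (ℕ → Bool) → List ℕ → ℕ
count p L = length (filterB p L)

_∩_ : List ℕ → List ℕ → List ℕ
L ∩ M = filterB (λ y → elem y M) L

filterB-cong : ∀ {p q} L → (∀ x → x ∈ L → p x ≡ q x) → filterB p L ≡ filterB q L
filterB-cong []      h = refl
filterB-cong {p} {q} (x ∷ L) h
  rewrite h x (here refl) | filterB-cong {p} {q} L (λ y m → h y (there m)) = refl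

filterB-filterB : ∀ p q L → filterB p (filterB q L) ≡ filterB (λ x → q x ∧ p x) L
filterB-filterB p q []      = refl
filterB-filterB p q (x ∷ L) with q x
... | false = filterB-filterB p q L
... | true with p x
...   | true  = cong (x ∷_) (filterB-filterB p q L)
...   | false = filterB-filterB p q L

filterB-++ : ∀ p A B → filterB p (A ++ B) ≡ filterB p A ++ filterB p B
filterB-++ p []      B = refl
filterB-++ p (x ∷ A) B with p x
... | true  = cong (x ∷_) (filterB-++ p A B)
... | false = filterB-++ p A B

filterB-all : ∀ p L → (∀ a → a ∈ L → p a ≡ true) → filterB p L ≡ L
filterB-all p []      h = refl
filterB-all p (x ∷ L) h rewrite h x (here refl) = cong (x ∷_) (filterB-all p L (λ a m → h a (there m)))

∈-filterB⁻ : ∀ p {x} L → x ∈ filterB p L → x ∈ L × p x ≡ true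
∈-filterB⁻ p (y ∷ L) m with p y in eq
∈-filterB⁻ p (y ∷ L) (here refl) | true = here refl , eq
∈-filterB⁻ p (y ∷ L) (there m)   | true = let (a , b) = ∈-filterB⁻ p L m in there a , b
∈-filterB⁻ p (y ∷ L) m           | false = let (a , b) = ∈-filterB⁻ p L m in there a , b

∈-filterB⁺ : ∀ p {x} L → x ∈ L → p x ≡ true → x ∈ filterB p L
∈-filterB⁺ p (y ∷ L) (here refl) px rewrite px = here refl
∈-filterB⁺ p (y ∷ L) (there m) px with p y
... | true  = there (∈-filterB⁺ p L m px)
... | false = ∈-filterB⁺ p L m px

elem-filterB⁻ : ∀ p L y → y ∈ᵇ filterB p L → y ∈ L × p y ≡ true
elem-filterB⁻ p L y m = ∈-filterB⁻ p L (elem⇒∈ _ m)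

elem-filterB⁺ : ∀ p L y → y ∈ L → p y ≡ true → y ∈ᵇ filterB p L
elem-filterB⁺ p L y yL py = ∈⇒elem (∈-filterB⁺ p L yL py)

filterB-unique : ∀ p L → Unique L → Unique (filterB p L)
filterB-unique p []      u        = []
filterB-unique p (x ∷ L) (px ∷ u) with p x
... | true  = All.tabulate (λ m → All.lookup px (proj₁ (∈-filterB⁻ p L m))) ∷ filterB-unique p L u
... | false = filterB-unique p L u

filterB-sameElems : ∀ p {A B} → SameElems A B → SameElems (filterB p A) (filterB p B)
filterB-sameElems p {A} {B} s y = ≡-by-true
  (λ m → let (yA , py) = elem-filterB⁻ p A y m in elem-filterB⁺ p B y (elem⇒∈ B (trans (sym (s y)) (∈⇒elem yA))) py)
  (λ m → let (yB , py) = elem-filterB⁻ p B y m in elem-filterB⁺ p A y (elem⇒∈ A (trans (s y) (∈⇒elem yB))) py)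

count-split : ∀ (q p : ℕ → Bool) L →
  count p L ≡ count (λ x → q x ∧ p x) L ℕ.+ count (λ x → not (q x) ∧ p x) L
count-split q p []      = refl
count-split q p (x ∷ L) with q x | p x
... | true  | true  = cong suc (count-split q p L)
... | true  | false = count-split q p L
... | false | true  = trans (cong suc (count-split q p L)) (sym (ℕₚ.+-suc _ _))
... | false | false = count-split q p L

count-partition : ∀ (q p : ℕ → Bool) L →
  count p L ≡ count p (filterB q L) ℕ.+ count p (filterB (λ x → not (q x)) L)
count-partition q p L = trans (count-split q p L)
  (cong₂ ℕ._+_ (cong length (sym (filterB-filterB p q L))) (cong length (sym (filterB-filterB p (λ x → not (q x)) L))))

count-≡0 : ∀ p L → (∀ x → x ∈ L → p x ≡ false) → count p L ≡ 0
count-≡0 p []      h = refl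
count-≡0 p (x ∷ L) h rewrite h x (here refl) = count-≡0 p L (λ y m → h y (there m))

count-≤ : ∀ p L → count p L ≤ length L
count-≤ p []      = z≤n
count-≤ p (x ∷ L) with p x
... | true  = s≤s (count-≤ p L)
... | false = ℕₚ.m≤n⇒m≤1+n (count-≤ p L)

count-< : ∀ p {x} L → x ∈ L → p x ≡ false → count p L < length L
count-< p (y ∷ L) (here refl) px rewrite px = s≤s (count-≤ p L)
count-< p (y ∷ L) (there m) px with p y
... | true  = s≤s (count-< p L m px)
... | false = ℕₚ.m≤n⇒m≤1+n (count-< p L m px)

-- Walks alternating between two perfect matchings

zigzag : (ℕ → ℕ) → (ℕ → ℕ) → ℕ → ℕ → ℕ
zigzag f h zero    w = w
zigzag f h (suc k) w = zigzag h f k (f w)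

alternate : ℕ → (ℕ → ℕ) → (ℕ → ℕ) → (ℕ → ℕ)
alternate zero    f h = f
alternate (suc k) f h = alternate k h f

double : ℕ → ℕ
double zero    = zero
double (suc t) = suc (suc (double t))

Reachable : (ℕ → ℕ) → (ℕ → ℕ) → ℕ → ℕ → Set
Reachable f h w z = Σ ℕ λ k → zigzag f h k w ≡ z

double-+ : ∀ j k → double (j ℕ.+ k) ≡ double j ℕ.+ double k
double-+ zero    k = refl
double-+ (suc j) k = cong (λ q → suc (suc q)) (double-+ j k)

double-suc : ∀ t → double t ℕ.+ 2 ≡ double (suc t)
double-suc t = trans (sym (double-+ t 1)) (cong double (ℕₚ.+-comm t 1))

m≤double : ∀ m → m ≤ double m
m≤double zero    = z≤n
m≤double (suc m) = s≤s (ℕₚ.m≤n⇒m≤1+n (m≤double m))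

parity : ∀ n → Σ ℕ λ m → n ≡ double m ⊎ n ≡ suc (double m)
parity zero = zero , inj₁ refl
parity (suc n) with parity n
... | m , inj₁ e = m , inj₂ (cong suc e)
... | m , inj₂ e = suc m , inj₁ (cong suc e)

zigzag-suc : ∀ f h k w → zigzag f h (suc k) w ≡ alternate k f h (zigzag f h k w)
zigzag-suc f h zero    w = refl
zigzag-suc f h (suc k) w = zigzag-suc h f k (f w)

zigzag-double-+ : ∀ t k f h w → zigzag f h (double t ℕ.+ k) w ≡ zigzag f h k (zigzag f h (double t) w)
zigzag-double-+ zero    k f h w = refl
zigzag-double-+ (suc t) k f h w = zigzag-double-+ t k f h (h (f w))

alternate-double-+ : ∀ t k f h → alternate (double t ℕ.+ k) f h ≡ alternate k f h
alternate-double-+ zero    k f h = refl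
alternate-double-+ (suc t) k f h = alternate-double-+ t k f h

alternate-double : ∀ t f h → alternate (double t) f h ≡ f
alternate-double zero    f h = refl
alternate-double (suc t) f h = alternate-double t f h

alternate-suc-double : ∀ t f h → alternate (suc (double t)) f h ≡ h
alternate-suc-double zero    f h = refl
alternate-suc-double (suc t) f h = alternate-suc-double t f h

alternate-cases : ∀ k f h →
  (alternate k f h ≡ f × alternate (suc k) f h ≡ h) ⊎ (alternate k f h ≡ h × alternate (suc k) f h ≡ f)
alternate-cases zero    f h = inj₁ (refl , refl)
alternate-cases (suc k) f h with alternate-cases k h f
... | inj₁ (a , b) = inj₂ (a , b)
... | inj₂ (a , b) = inj₁ (a , b)

zigzag-odd : ∀ j f h w → zigzag f h (suc (double j)) w ≡ f (zigzag f h (double j) w)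
zigzag-odd j f h w = trans (zigzag-suc f h (double j) w) (cong (λ p → p (zigzag f h (double j) w)) (alternate-double j f h))

zigzag-even : ∀ j f h w → zigzag f h (double (suc j)) w ≡ h (zigzag f h (suc (double j)) w)
zigzag-even j f h w =
  trans (zigzag-suc f h (suc (double j)) w) (cong (λ p → p (zigzag f h (suc (double j)) w)) (alternate-suc-double j f h))

zigzag-double-suc : ∀ j f h y → zigzag f h (double (suc j)) y ≡ h (f (zigzag f h (double j) y))
zigzag-double-suc j f h y = trans (cong (λ q → zigzag f h q y) (sym (double-suc j))) (zigzag-double-+ j 2 f h y)

elem-walk⁻ : ∀ n f h w z → z ∈ᵇ walk f h n w → Σ ℕ λ k → k < n × zigzag f h k w ≡ z
elem-walk⁻ (suc n) f h w z e with ∨-true⁻ (z ≡ᵇ w) e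
... | inj₁ p = zero , s≤s z≤n , sym (ℕₚ.≡ᵇ⇒≡ z w (true⇒T p))
... | inj₂ p = let (k , k<n , q) = elem-walk⁻ n h f (f w) z p in suc k , s≤s k<n , q

elem-walk⁺ : ∀ n f h w k → k < n → zigzag f h k w ∈ᵇ walk f h n w
elem-walk⁺ (suc n) f h w zero    lt rewrite ≡ᵇ-refl w = refl
elem-walk⁺ (suc n) f h w (suc k) (s≤s lt) = ∨-trueʳ (zigzag h f k (f w) ≡ᵇ w) (elem-walk⁺ n h f (f w) k lt)

module Alternating (V : List ℕ) (f h : ℕ → ℕ) (f-match : IsMatching V f) (h-match : IsMatching V h) where

  n : ℕ
  n = length V

  alternate-matching : ∀ k → IsMatching V (alternate k f h)
  alternate-matching k with alternate-cases k f h
  ... | inj₁ (a , _) rewrite a = f-match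
  ... | inj₂ (a , _) rewrite a = h-match

  zigzag-∈ : ∀ {w} → w ∈ V → ∀ k → zigzag f h k w ∈ V
  zigzag-∈ wV zero = wV
  zigzag-∈ {w} wV (suc k) rewrite zigzag-suc f h k w = proj₁ (alternate-matching k _ (zigzag-∈ wV k))

  module From (w : ℕ) (wV : w ∈ V) where

    x : ℕ → ℕ
    x k = zigzag f h k w

    x-∈ : ∀ k → x k ∈ V
    x-∈ = zigzag-∈ wV

    x-back : ∀ k → x k ≡ alternate k f h (x (suc k))
    x-back k = sym (trans (cong (alternate k f h) (zigzag-suc f h k w))
                          (proj₁ (proj₂ (alternate-matching k _ (x-∈ k)))))

    x-back-zigzag : ∀ k i →
      zigzag (alternate (suc (i ℕ.+ k)) f h) (alternate (i ℕ.+ k) f h) k (x (i ℕ.+ k)) ≡ x i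
    x-back-zigzag zero    i = cong x (ℕₚ.+-identityʳ i)
    x-back-zigzag (suc k) i rewrite ℕₚ.+-suc i k =
      trans (cong (zigzag (alternate (suc (i ℕ.+ k)) f h) (alternate (i ℕ.+ k) f h) k) (sym (x-back (i ℕ.+ k))))
            (x-back-zigzag k i)

    retrace : ∀ j d → zigzag f h (suc (double j)) (x (suc (double (j ℕ.+ d)))) ≡ x (double d)
    retrace j d = begin
        zigzag f h (suc (double j)) (x K)
      ≡⟨ cong₂ (λ p q → zigzag p q (suc (double j)) (x K))
               (sym (alternate-double (j ℕ.+ d) f h)) (sym (alternate-suc-double (j ℕ.+ d) f h)) ⟩
        zigzag (alternate (suc K) f h) (alternate K f h) (suc (double j)) (x K)
      ≡⟨ cong (λ q → zigzag (alternate (suc q) f h) (alternate q f h) (suc (double j)) (x q)) (sym K≡) ⟩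
        zigzag (alternate (suc (double d ℕ.+ suc (double j))) f h) (alternate (double d ℕ.+ suc (double j)) f h)
               (suc (double j)) (x (double d ℕ.+ suc (double j)))
      ≡⟨ x-back-zigzag (suc (double j)) (double d) ⟩
        x (double d)
      ∎
      where
      open ≡-Reasoning
      K : ℕ
      K = suc (double (j ℕ.+ d))
      K≡ : double d ℕ.+ suc (double j) ≡ K
      K≡ = trans (ℕₚ.+-suc (double d) (double j))
                 (cong suc (trans (ℕₚ.+-comm (double d) (double j)) (sym (double-+ j d))))

    -- Shrinking an odd gap from both ends leaves a single step x a ≡ x (suc a),
    -- a fixed point of f or h.
    no-odd-return : ∀ m a → x a ≢ x (suc (double m ℕ.+ a))
    no-odd-return zero a e =
      proj₂ (proj₂ (alternate-matching a _ (x-∈ a))) (trans (sym (zigzag-suc f h a w)) (sym e))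
    no-odd-return (suc m) a e =
      no-odd-return m (suc a) (trans e₁ (cong x (sym (cong suc (ℕₚ.+-suc (double m) a)))))
      where
      B : ℕ
      B = suc (suc (double m ℕ.+ a))
      e₁ : x (suc a) ≡ x B
      e₁ = trans (zigzag-suc f h a w)
             (trans (cong (alternate a f h) e)
               (trans (cong (λ p → p (x (suc B))) (sym (alternate-double-+ (suc m) a f h))) (sym (x-back B))))

    even-return : ∀ a m → x a ≡ x (double m ℕ.+ a) → w ≡ x (double m)
    even-return zero    m e = trans e (cong x (ℕₚ.+-identityʳ (double m)))
    even-return (suc a) m e = even-return a m
      (trans (x-back a) (trans (cong (alternate a f h) (trans e (cong x (ℕₚ.+-suc (double m) a))))
        (trans (cong (λ p → p (x (suc (double m ℕ.+ a)))) (sym (alternate-double-+ m a f h)))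
               (sym (x-back (double m ℕ.+ a))))))

    index : Fin (suc n) → Fin n
    index i = Any.index (x-∈ (toℕ i))

    index-injective : ∀ i j → index i ≡ index j → x (toℕ i) ≡ x (toℕ j)
    index-injective i j e = trans (Anyₚ.lookup-index (x-∈ (toℕ i)))
      (trans (cong (lookup V) e) (sym (Anyₚ.lookup-index (x-∈ (toℕ j)))))

    -- By pigeonhole two of x 0, …, x n coincide; the gap is even by
    -- no-odd-return, and even-return moves the repetition back to w.
    period : Σ ℕ λ m → 1 ≤ m × double m ≤ n × x (double m) ≡ w
    period with Finₚ.pigeonhole (ℕₚ.n<1+n n) index
    ... | i , j , i<j , e with parity (toℕ j ∸ toℕ i)
    ... | m , inj₂ gap = ⊥-elim (no-odd-return m (toℕ i) (trans (index-injective i j e)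
            (cong x (trans (sym (ℕₚ.m∸n+n≡m (ℕₚ.<⇒≤ i<j))) (cong (ℕ._+ toℕ i) gap)))))
    ... | zero , inj₁ gap = ⊥-elim (ℕₚ.<⇒≱ i<j (ℕₚ.m∸n≡0⇒m≤n gap))
    ... | suc m , inj₁ gap = suc m , s≤s z≤n , bound ,
            sym (even-return (toℕ i) (suc m) (trans (index-injective i j e)
              (cong x (trans (sym (ℕₚ.m∸n+n≡m (ℕₚ.<⇒≤ i<j))) (cong (ℕ._+ toℕ i) gap)))))
      where
      bound : double (suc m) ≤ n
      bound = subst (_≤ n) gap (ℕₚ.≤-trans (ℕₚ.m∸n≤m (toℕ j) (toℕ i)) (ℕₚ.≤-pred (Finₚ.toℕ<n j)))

    bounded-index : ∀ k → Σ ℕ λ k′ → k′ < n × x k ≡ x k′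
    bounded-index k with period
    ... | zero , () , _
    ... | suc m , _ , le , back = let (k′ , lt , e) = go k k ℕₚ.≤-refl in k′ , ℕₚ.<-≤-trans lt le , e
      where
      p : ℕ
      p = double (suc m)
      go : ∀ fuel k → k ≤ fuel → Σ ℕ λ k′ → k′ < p × x k ≡ x k′
      go zero .zero z≤n = zero , s≤s z≤n , refl
      go (suc fuel) k le with k ℕₚ.<? p
      ... | yes lt = k , lt , refl
      ... | no nlt =
        let k-p = k ∸ p
            split : p ℕ.+ k-p ≡ k
            split = ℕₚ.m+[n∸m]≡n (ℕₚ.≮⇒≥ nlt)
            smaller : k-p ≤ fuel
            smaller = ℕₚ.≤-pred (ℕₚ.≤-trans (s≤s (ℕₚ.≤-trans (ℕₚ.m≤n+m k-p (double m)) (ℕₚ.n≤1+n _)))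
                                             (subst (_≤ suc fuel) (sym split) le))
            (k′ , lt , e) = go fuel k-p smaller
        in k′ , lt , trans (cong x (sym split))
                       (trans (trans (zigzag-double-+ (suc m) k-p f h w) (cong (zigzag f h k-p) back)) e)

    reach-backward : ∀ k → Reachable f h w (alternate (suc k) f h (x k))
    reach-backward k with period
    ... | zero , () , _
    ... | suc m , _ , _ , back = suc (double m ℕ.+ k) ,
      trans (x-back (suc (double m ℕ.+ k)))
        (trans (cong (λ p → p (x (double (suc m) ℕ.+ k))) (alternate-double-+ m k h f))
               (cong (alternate k h f) (trans (zigzag-double-+ (suc m) k f h w) (cong (zigzag f h k) back))))

  reach-f-h : ∀ {w} → w ∈ V → ∀ k →
    Reachable f h w (f (zigzag f h k w)) × Reachable f h w (h (zigzag f h k w))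
  reach-f-h {w} wV k with alternate-cases k f h
  ... | inj₁ (a , b) = subst (λ p → Reachable f h w (p (zigzag f h k w))) a (suc k , zigzag-suc f h k w)
                     , subst (λ p → Reachable f h w (p (zigzag f h k w))) b (From.reach-backward w wV k)
  ... | inj₂ (a , b) = subst (λ p → Reachable f h w (p (zigzag f h k w))) b (From.reach-backward w wV k)
                     , subst (λ p → Reachable f h w (p (zigzag f h k w))) a (suc k , zigzag-suc f h k w)

  reach-f : ∀ {w z} → w ∈ V → Reachable f h w z → Reachable f h w (f z)
  reach-f wV (k , refl) = proj₁ (reach-f-h wV k)

  reach-h : ∀ {w z} → w ∈ V → Reachable f h w z → Reachable f h w (h z)
  reach-h wV (k , refl) = proj₂ (reach-f-h wV k)

  reach-alternate : ∀ {w z} → w ∈ V → Reachable f h w z → ∀ j → Reachable f h w (alternate j f h z)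
  reach-alternate wV p j with alternate-cases j f h
  ... | inj₁ (c , _) rewrite c = reach-f wV p
  ... | inj₂ (c , _) rewrite c = reach-h wV p

  reach-zigzag : ∀ {w z} → w ∈ V → Reachable f h w z → ∀ j →
    Reachable f h w (zigzag f h j z) × Reachable f h w (zigzag h f j z)
  reach-zigzag wV p zero    = p , p
  reach-zigzag wV p (suc j) = proj₂ (reach-zigzag wV (reach-f wV p) j) , proj₁ (reach-zigzag wV (reach-h wV p) j)

  reach-∈ : ∀ {w z} → w ∈ V → Reachable f h w z → z ∈ V
  reach-∈ wV (k , refl) = zigzag-∈ wV k

  reach-refl : ∀ {w} → Reachable f h w w
  reach-refl = zero , refl

  reach-trans : ∀ {w z y} → w ∈ V → Reachable f h w z → Reachable f h z y → Reachable f h w y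
  reach-trans wV p (j , refl) = proj₁ (reach-zigzag wV p j)

  reach-sym : ∀ {w z} → w ∈ V → Reachable f h w z → Reachable f h z w
  reach-sym {w} {z} wV (k , refl) = go 0 k refl
    where
    zV : zigzag f h k w ∈ V
    zV = zigzag-∈ wV k
    go : ∀ j d → j ℕ.+ d ≡ k → Reachable f h z (zigzag f h j w)
    go j zero    e = zero , cong (λ i → zigzag f h i w) (sym (trans (sym (ℕₚ.+-identityʳ j)) e))
    go j (suc d) e = subst (Reachable f h z) (sym (From.x-back w wV j))
                       (reach-alternate zV (go (suc j) d (trans (sym (ℕₚ.+-suc j d)) e)) j)

  reach⇒elem-walk : ∀ {w z} → w ∈ V → Reachable f h w z → z ∈ᵇ walk f h n w
  reach⇒elem-walk {w} wV (k , refl) with From.bounded-index w wV k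
  ... | k′ , lt , e = subst (_∈ᵇ walk f h n w) (sym e) (elem-walk⁺ n f h w k′ lt)

  elem-cyc⁻ : ∀ {w z} → z ∈ᵇ cyc V f h w → z ∈ V × Reachable f h w z
  elem-cyc⁻ {w} {z} m with elem-filterB⁻ (λ z → elem z (walk f h n w)) V z m
  ... | zV , p = zV , (let (k , _ , e) = elem-walk⁻ n f h w z p in k , e)

  elem-cyc⁺ : ∀ {w z} → w ∈ V → z ∈ V → Reachable f h w z → z ∈ᵇ cyc V f h w
  elem-cyc⁺ {w} wV zV p = elem-filterB⁺ (λ z → elem z (walk f h n w)) V _ zV (reach⇒elem-walk wV p)

  elem-cyc-self : ∀ {w} → w ∈ V → w ∈ᵇ cyc V f h w
  elem-cyc-self wV = elem-cyc⁺ wV wV reach-refl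

  cyc-sameElems : ∀ {w z} → w ∈ V → z ∈ᵇ cyc V f h w → SameElems (cyc V f h z) (cyc V f h w)
  cyc-sameElems {w} {z} wV m y with elem-cyc⁻ m
  ... | zV , p = ≡-by-true
    (λ q → let (yV , r) = elem-cyc⁻ {z = y} q in elem-cyc⁺ wV yV (reach-trans wV p r))
    (λ q → let (yV , r) = elem-cyc⁻ {z = y} q in elem-cyc⁺ zV yV (reach-trans zV (reach-sym wV p) r))

  zigzag-agree : ∀ {w} f′ → w ∈ V → (∀ z → Reachable f h w z → f z ≡ f′ z) →
    ∀ k z → Reachable f h w z → zigzag f h k z ≡ zigzag f′ h k z × zigzag h f k z ≡ zigzag h f′ k z
  zigzag-agree f′ wV agree zero    z p = refl , refl
  zigzag-agree f′ wV agree (suc k) z p =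
      trans (proj₂ (zigzag-agree f′ wV agree k (f z) (reach-f wV p))) (cong (zigzag h f′ k) (agree z p))
    , proj₁ (zigzag-agree f′ wV agree k (h z) (reach-h wV p))

reach-swap : ∀ V f h → IsMatching V f → IsMatching V h → ∀ {w z} → w ∈ V →
  Reachable f h w z → Reachable h f w z
reach-swap V f h f-match h-match wV (k , refl) = proj₂ (Alternating.reach-zigzag V h f h-match f-match wV (zero , refl) k)

cyc-sameElems-by-reach : ∀ {V f h f′ h′} → IsMatching V f → IsMatching V h → IsMatching V f′ → IsMatching V h′ →
  ∀ {w} → w ∈ V →
  (∀ z → Reachable f h w z → Reachable f′ h′ w z) → (∀ z → Reachable f′ h′ w z → Reachable f h w z) →
  SameElems (cyc V f h w) (cyc V f′ h′ w)
cyc-sameElems-by-reach {V} {f} {h} {f′} {h′} f-match h-match f′-match h′-match wV to from y = ≡-by-true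
  (λ m → let (yV , p) = A.elem-cyc⁻ m in A′.elem-cyc⁺ wV yV (to y p))
  (λ m → let (yV , p) = A′.elem-cyc⁻ m in A.elem-cyc⁺ wV yV (from y p))
  where
  module A  = Alternating V f h f-match h-match
  module A′ = Alternating V f′ h′ f′-match h′-match

cyc-sameElems-swap : ∀ {V f h} → IsMatching V f → IsMatching V h → ∀ {w} → w ∈ V →
  SameElems (cyc V f h w) (cyc V h f w)
cyc-sameElems-swap {V} {f} {h} f-match h-match wV = cyc-sameElems-by-reach f-match h-match h-match f-match wV
  (λ z → reach-swap V f h f-match h-match wV) (λ z → reach-swap V h f h-match f-match wV)

cyc-sameElems-by-zigzag : ∀ {V f h f′} → IsMatching V f → IsMatching V h → IsMatching V f′ → ∀ {w} → w ∈ V →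
  (∀ k → zigzag f h k w ≡ zigzag f′ h k w) → SameElems (cyc V f h w) (cyc V f′ h w)
cyc-sameElems-by-zigzag f-match h-match f′-match wV same = cyc-sameElems-by-reach f-match h-match f′-match h-match wV
  (λ z (k , e) → k , trans (sym (same k)) e) (λ z (k , e) → k , trans (same k) e)

-- Counting representatives of classes

all-true⁻ : ∀ (p : ℕ → Bool) L → all p L ≡ true → ∀ y → y ∈ L → p y ≡ true
all-true⁻ p (x ∷ L) e y (here refl) = proj₁ (∧-true⁻ e)
all-true⁻ p (x ∷ L) e y (there m)   = all-true⁻ p L (proj₂ (∧-true⁻ {p x} e)) y m

all-true⁺ : ∀ (p : ℕ → Bool) L → (∀ y → y ∈ L → p y ≡ true) → all p L ≡ true
all-true⁺ p []      h = refl
all-true⁺ p (x ∷ L) h = ∧-true⁺ (h x (here refl)) (all-true⁺ p L (λ y m → h y (there m)))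

all-false⁻ : ∀ (p : ℕ → Bool) L → all p L ≡ false → Σ ℕ λ y → y ∈ L × p y ≡ false
all-false⁻ p (x ∷ L) e with p x in e₁
... | false = x , here refl , e₁
... | true  = let (y , m , q) = all-false⁻ p L e in y , there m , q

all-sameElems : ∀ (p : ℕ → Bool) {M M′} → SameElems M M′ → all p M ≡ all p M′
all-sameElems p {M} {M′} s = ≡-by-true
  (λ a → all-true⁺ p M′ (λ y m → all-true⁻ p M a y (elem⇒∈ M (trans (s y) (∈⇒elem m)))))
  (λ a → all-true⁺ p M (λ y m → all-true⁻ p M′ a y (elem⇒∈ M′ (trans (sym (s y)) (∈⇒elem m)))))

isMin-sameElems : ∀ w {M M′} → SameElems M M′ → isMin w M ≡ isMin w M′
isMin-sameElems w {M} {M′} = all-sameElems (w ≤ᵇ_) {M} {M′}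

isMin⇒≤ : ∀ w M z → isMin w M ≡ true → z ∈ M → w ≤ z
isMin⇒≤ w M z e zM = ℕₚ.≤ᵇ⇒≤ w z (true⇒T (all-true⁻ (w ≤ᵇ_) M e z zM))

least-∈ : ∀ y K → Σ ℕ λ m → m ∈ y ∷ K × (∀ z → z ∈ y ∷ K → m ≤ z)
least-∈ y [] = y , here refl , λ { z (here refl) → ℕₚ.≤-refl }
least-∈ y (k ∷ K) with least-∈ k K
... | m , mK , m≤ with y ℕₚ.≤? m
... | yes y≤m = y , here refl , λ { z (here refl) → ℕₚ.≤-refl ; z (there zK) → ℕₚ.≤-trans y≤m (m≤ z zK) }
... | no  y≰m = m , there mK , λ { z (here refl) → ℕₚ.<⇒≤ (ℕₚ.≰⇒> y≰m) ; z (there zK) → m≤ z zK }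

count-≡ᵇ : ∀ m K → Unique K → m ∈ K → count (_≡ᵇ m) K ≡ 1
count-≡ᵇ m (y ∷ K) (px ∷ u) (here refl) rewrite ≡ᵇ-refl m =
  cong suc (count-≡0 (_≡ᵇ m) K (λ z zK → ¬-not (λ e → All.lookup px zK (sym (ℕₚ.≡ᵇ⇒≡ z m (true⇒T e))))))
count-≡ᵇ m (y ∷ K) (px ∷ u) (there mK) with y ≡ᵇ m in e
... | true  = ⊥-elim (All.lookup px mK (ℕₚ.≡ᵇ⇒≡ y m (true⇒T e)))
... | false = count-≡ᵇ m K u mK

count-isMin : ∀ K M → Unique K → SameElems M K → ∀ {z₀} → z₀ ∈ K → count (λ z → isMin z M) K ≡ 1
count-isMin (y ∷ K) M u s _ with least-∈ y K
... | m , mK , m≤ = trans (cong length (filterB-cong (y ∷ K) isMin⇔≡m)) (count-≡ᵇ m (y ∷ K) u mK)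
  where
  M⇒K : ∀ {q} → q ∈ M → q ∈ y ∷ K
  M⇒K {q} qM = elem⇒∈ (y ∷ K) (trans (sym (s q)) (∈⇒elem qM))
  isMin⇔≡m : ∀ z → z ∈ y ∷ K → isMin z M ≡ (z ≡ᵇ m)
  isMin⇔≡m z zK = ≡-by-true
    (λ a → subst (λ q → (z ≡ᵇ q) ≡ true)
             (ℕₚ.≤-antisym (isMin⇒≤ z M m a (elem⇒∈ M (trans (s m) (∈⇒elem mK)))) (m≤ z zK)) (≡ᵇ-refl z))
    (λ a → subst (λ q → isMin q M ≡ true) (sym (ℕₚ.≡ᵇ⇒≡ z m (true⇒T a)))
             (all-true⁺ (m ≤ᵇ_) M (λ q qM → T⇒true (ℕₚ.≤⇒≤ᵇ (m≤ q (M⇒K qM))))))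

other-class-∩ : ∀ (κ : ℕ → List ℕ) L {w₀ w} →
  (∀ w → w ∈ L → w ∈ᵇ κ w) →
  (∀ w z → w ∈ L → z ∈ L → z ∈ᵇ κ w → SameElems (κ z) (κ w)) →
  w₀ ∈ L → w ∈ L → w ∉ᵇ κ w₀ → filterB (λ y → not (elem y (κ w₀))) L ∩ κ w ≡ L ∩ κ w
other-class-∩ κ L {w₀} {w} self same w₀∈L w∈L w∉κw₀ =
  trans (filterB-filterB (λ y → elem y (κ w)) (λ y → not (elem y (κ w₀))) L) (filterB-cong L outside)
  where
  outside : ∀ y → y ∈ L → (not (elem y (κ w₀)) ∧ elem y (κ w)) ≡ elem y (κ w)
  outside y y∈L with elem y (κ w) in y∈κw
  ... | false = ∧-zeroʳ _
  ... | true with elem y (κ w₀) in y∈κw₀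
  ...   | false = refl
  ...   | true  = ⊥-elim (false≢true (trans (sym w∉κw₀)
                    (trans (sym (same w₀ y w₀∈L y∈L y∈κw₀ w))
                           (trans (same w y w∈L y∈L y∈κw w) (self w w∈L)))))

count-by-classes : ∀ (κ : ℕ → List ℕ) (Q Q′ : ℕ → Bool) L →
  (∀ w → w ∈ L → w ∈ᵇ κ w) →
  (∀ w z → w ∈ L → z ∈ L → z ∈ᵇ κ w → SameElems (κ z) (κ w)) →
  (∀ w → w ∈ L → count Q (L ∩ κ w) ≡ count Q′ (L ∩ κ w)) →
  count Q L ≡ count Q′ L
count-by-classes κ Q Q′ xs = go (length xs) xs ℕₚ.≤-refl
  where
  go : ∀ fuel L → length L ≤ fuel →
    (∀ w → w ∈ L → w ∈ᵇ κ w) →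
    (∀ w z → w ∈ L → z ∈ L → z ∈ᵇ κ w → SameElems (κ z) (κ w)) →
    (∀ w → w ∈ L → count Q (L ∩ κ w) ≡ count Q′ (L ∩ κ w)) →
    count Q L ≡ count Q′ L
  go fuel       []        le self same per-class = refl
  go (suc fuel) (w₀ ∷ L₀) le self same per-class =
    trans (count-partition inK Q L)
      (trans (cong₂ ℕ._+_ (per-class w₀ (here refl)) rest-equal) (sym (count-partition inK Q′ L)))
    where
    L : List ℕ
    L = w₀ ∷ L₀
    inK : ℕ → Bool
    inK y = elem y (κ w₀)
    rest : List ℕ
    rest = filterB (λ y → not (inK y)) L
    rest⁻ : ∀ {y} → y ∈ rest → y ∈ L × not (inK y) ≡ true
    rest⁻ = ∈-filterB⁻ _ L
    rest-shorter : length rest ≤ fuel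
    rest-shorter =
      ℕₚ.≤-pred (ℕₚ.≤-trans (count-< (λ y → not (inK y)) L (here refl) (cong not (self w₀ (here refl)))) le)
    class-in-rest : ∀ w → w ∈ rest → rest ∩ κ w ≡ L ∩ κ w
    class-in-rest w m = other-class-∩ κ L self same (here refl) (proj₁ (rest⁻ m))
                          (trans (sym (not-involutive _)) (cong not (proj₂ (rest⁻ m))))
    rest-equal : count Q rest ≡ count Q′ rest
    rest-equal = go fuel rest rest-shorter (λ w m → self w (proj₁ (rest⁻ m)))
      (λ w z m₁ m₂ → same w z (proj₁ (rest⁻ m₁)) (proj₁ (rest⁻ m₂)))
      (λ w m → trans (cong (count Q) (class-in-rest w m))
                 (trans (per-class w (proj₁ (rest⁻ m))) (cong (count Q′) (sym (class-in-rest w m)))))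

-- Suppressing the vertices of a closed set

piecewise : List ℕ → (ℕ → ℕ) → (ℕ → ℕ) → ℕ → ℕ
piecewise T f₁ f₂ x = if elem x T then f₁ x else f₂ x

Closed : List ℕ → List ℕ → (ℕ → ℕ) → Set
Closed V T f = ∀ y → y ∈ V → y ∈ᵇ T → f y ∈ᵇ T

closed-complement : ∀ {V T f} → IsMatching V f → Closed V T f → ∀ y → y ∈ V → y ∉ᵇ T → f y ∉ᵇ T
closed-complement {V} {T} {f} f-match closed y yV y∉T = ¬-not (λ fy∈T → false≢true (trans (sym y∉T)
  (subst (_∈ᵇ T) (proj₁ (proj₂ (f-match y yV))) (closed (f y) (proj₁ (f-match y yV)) fy∈T))))

first-false : ∀ (p : ℕ → Bool) m → p m ≡ false →
  Σ ℕ λ a → a ≤ m × p a ≡ false × (∀ j → j < a → p j ≡ true)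
first-false p zero    e = zero , z≤n , e , λ j ()
first-false p (suc m) e with p 0 in e₀
... | false = zero , z≤n , e₀ , λ j ()
... | true  = let (a , le , pa , h) = first-false (λ k → p (suc k)) m e
              in suc a , s≤s le , pa , λ { zero _ → e₀ ; (suc j) (s≤s lt) → h j lt }

follow-first-exit : ∀ S g c n a y → (∀ j → j < a → zigzag c g (double j) y ∈ᵇ S) →
  zigzag c g (double a) y ∉ᵇ S → a ≤ n → follow S g c n y ≡ zigzag c g (double a) y
follow-first-exit S g c zero    zero    y inside exit le = refl
follow-first-exit S g c (suc n) zero    y inside exit le rewrite exit = refl
follow-first-exit S g c (suc n) (suc a) y inside exit (s≤s le) rewrite inside 0 (s≤s z≤n) =
  follow-first-exit S g c n a (g (c y)) (λ j lt → inside (suc j) (s≤s lt)) exit le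

-- For V = verts H, g = g H and β = b H, the gehm remove H S c has vertex list V′ and g-colour gˢ.
module Suppression (V : List ℕ) (V-unique : Unique V) (S : List ℕ) (g c β : ℕ → ℕ)
                   (g-match : IsMatching V g) (c-match : IsMatching V c)
                   (φ-match : IsMatching V (piecewise S c β)) (S-closed : Closed V S c) where

  φ : ℕ → ℕ
  φ = piecewise S c β

  n : ℕ
  n = length V

  gˢ : ℕ → ℕ
  gˢ x = follow S g c n (g x)

  outside : ℕ → Bool
  outside v = not (elem v S)

  V′ : List ℕ
  V′ = filterB outside V

  ∈V′⁻ : ∀ {x} → x ∈ V′ → x ∈ V × x ∉ᵇ S
  ∈V′⁻ m with ∈-filterB⁻ outside V m
  ... | xV , e = xV , trans (sym (not-involutive _)) (cong not e)

  ∈V′⁺ : ∀ {x} → x ∈ V → x ∉ᵇ S → x ∈ V′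
  ∈V′⁺ xV e = ∈-filterB⁺ outside V xV (cong not e)

  φ-outside : ∀ x → x ∉ᵇ S → φ x ≡ β x
  φ-outside x e rewrite e = refl

  φ-inside : ∀ x → x ∈ᵇ S → φ x ≡ c x
  φ-inside x e rewrite e = refl

  φ-keeps-outside : ∀ x → x ∈ V → x ∉ᵇ S → φ x ∉ᵇ S
  φ-keeps-outside = closed-complement {V} {S} {φ} φ-match
    (λ y yV y∈S → subst (_∈ᵇ S) (sym (φ-inside y y∈S)) (S-closed y yV y∈S))

  β-match : IsMatching V′ β
  β-match x xV′ with ∈V′⁻ xV′
  ... | xV , x∉S = subst (_∈ V′) (φ-outside x x∉S) (∈V′⁺ (proj₁ (φ-match x xV)) φx∉S)
                 , trans (cong β (sym (φ-outside x x∉S)))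
                         (trans (sym (φ-outside (φ x) φx∉S)) (proj₁ (proj₂ (φ-match x xV))))
                 , subst (_≢ x) (φ-outside x x∉S) (proj₂ (proj₂ (φ-match x xV)))
    where
    φx∉S : φ x ∉ᵇ S
    φx∉S = φ-keeps-outside x xV x∉S

  module GC = Alternating V g c g-match c-match

  return-from-outside : ∀ x m → x ∈ V → x ∉ᵇ S → zigzag g c (double (suc m)) x ≡ x →
    zigzag c g (double m) (g x) ∉ᵇ S
  return-from-outside x m xV x∉S back = ¬-not (λ e → false≢true (trans (sym x∉S)
    (subst (_∈ᵇ S) (sym x≡c[last]) (S-closed _ (GC.zigzag-∈ xV (suc (double m))) e))))
    where
    x≡c[last] : x ≡ c (zigzag c g (double m) (g x))
    x≡c[last] = trans (sym back) (trans (zigzag-suc g c (suc (double m)) x)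
                  (cong (λ p → p (zigzag c g (double m) (g x))) (alternate-suc-double m g c)))

  gˢ-exit : ∀ x → x ∈ V → x ∉ᵇ S →
    Σ ℕ λ a → a < n × (∀ j → j < a → zigzag c g (double j) (g x) ∈ᵇ S)
              × zigzag c g (double a) (g x) ∉ᵇ S × gˢ x ≡ zigzag c g (double a) (g x)
  gˢ-exit x xV x∉S with GC.From.period x xV
  ... | zero , () , _
  ... | suc m , _ , le , back
      with first-false (λ j → elem (zigzag c g (double j) (g x)) S) m (return-from-outside x m xV x∉S back)
  ... | a , a≤m , exit , inside =
    a , a<n , inside , exit , follow-first-exit S g c n a (g x) inside exit (ℕₚ.<⇒≤ a<n)
    where
    a<n : a < n
    a<n = ℕₚ.≤-trans (s≤s (ℕₚ.≤-trans a≤m (ℕₚ.≤-trans (m≤double m) (ℕₚ.n≤1+n _)))) le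

  -- Walking back from gˢ x retraces the walk from x, so gˢ is an involution;
  -- it has no fixed point because the (g, c)-walk never returns after an odd number of steps.
  gˢ-match : IsMatching V′ gˢ
  gˢ-match x xV′ with ∈V′⁻ xV′
  ... | xV , x∉S with gˢ-exit x xV x∉S
  ... | a , a<n , inside , exit , gˢx≡y =
    subst (_∈ V′) (sym gˢx≡y) (∈V′⁺ (GC.zigzag-∈ xV (suc (double a))) exit) , involutive , fixed-point-free
    where
    s : ℕ → ℕ
    s k = zigzag g c k x
    y : ℕ
    y = s (suc (double a))
    retrace : ∀ j d → a ≡ j ℕ.+ d → zigzag c g (double j) (g y) ≡ s (double d)
    retrace j d e = subst (λ q → zigzag c g (double j) (g (s (suc (double q)))) ≡ s (double d)) (sym e)
                          (GC.From.retrace x xV j d)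
    retrace-inside : ∀ j → j < a → zigzag c g (double j) (g y) ∈ᵇ S
    retrace-inside j j<a with ℕₚ.m≤n⇒∃[o]m+o≡n j<a
    ... | d , e = subst (_∈ᵇ S) (sym (trans (retrace j (suc d) (sym (trans (ℕₚ.+-suc j d) e))) s≡c))
                    (S-closed _ (GC.zigzag-∈ xV (suc (double d))) (inside d d<a))
      where
      s≡c : s (double (suc d)) ≡ c (zigzag c g (double d) (g x))
      s≡c = zigzag-even d g c x
      d<a : d < a
      d<a = subst (d <_) e (s≤s (ℕₚ.m≤n+m d j))
    retrace-all : zigzag c g (double a) (g y) ≡ x
    retrace-all = retrace a 0 (sym (ℕₚ.+-identityʳ a))
    involutive : gˢ (gˢ x) ≡ x
    involutive = trans (cong gˢ gˢx≡y)
      (trans (follow-first-exit S g c n a (g y) retrace-inside (subst (_∉ᵇ S) (sym retrace-all) x∉S) (ℕₚ.<⇒≤ a<n))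
             retrace-all)
    fixed-point-free : gˢ x ≢ x
    fixed-point-free e = GC.From.no-odd-return x xV a 0
      (trans (sym e) (trans gˢx≡y (cong s (cong suc (sym (ℕₚ.+-identityʳ (double a)))))))

  module Old = Alternating V φ g φ-match g-match
  module New = Alternating V′ β gˢ β-match gˢ-match

  module Walks (w : ℕ) (wV′ : w ∈ V′) where

    wV : w ∈ V
    wV = proj₁ (∈V′⁻ wV′)

    old : ℕ → ℕ
    old k = zigzag φ g k w

    new : ℕ → ℕ
    new k = zigzag β gˢ k w

    old-∈ : ∀ k → old k ∈ V
    old-∈ = Old.zigzag-∈ wV

    new-outside : ∀ k → new k ∉ᵇ S
    new-outside k = proj₂ (∈V′⁻ (New.zigzag-∈ wV′ k))

    -- A β-step and a gˢ-step of the new walk cover a φ-step and a g-step of the old walk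
    -- followed by the a pairs of (c, g)-steps that the old walk spends inside S.
    next-exit : ∀ k j → new (double k) ≡ old (double j) → old (double j) ∉ᵇ S →
      Σ ℕ λ a → new (double (suc k)) ≡ old (double (suc (j ℕ.+ a)))
              × (∀ l → l < a → old (double (suc (j ℕ.+ l))) ∈ᵇ S)
              × old (double (suc (j ℕ.+ a))) ∉ᵇ S
    next-exit k j same j-out
        with gˢ-exit (old (suc (double j))) (old-∈ (suc (double j)))
                     (subst (_∉ᵇ S) (sym (zigzag-odd j φ g w)) (φ-keeps-outside (old (double j)) (old-∈ (double j)) j-out))
    ... | a , a<n , inside , exit , gˢ≡ =
      a , new≡old , (λ l l<a → subst (_∈ᵇ S) (run l (ℕₚ.<⇒≤ l<a)) (inside l l<a))
        , subst (_∉ᵇ S) (run a ℕₚ.≤-refl) exit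
      where
      v : ℕ
      v = old (suc (double j))
      run : ∀ l → l ≤ a → zigzag c g (double l) (g v) ≡ old (double (suc (j ℕ.+ l)))
      run zero _ rewrite ℕₚ.+-identityʳ j = sym (zigzag-even j φ g w)
      run (suc l) l<a rewrite ℕₚ.+-suc j l =
        trans (zigzag-double-suc l c g (g v)) (trans (cong (λ q → g (c q)) (run l (ℕₚ.<⇒≤ l<a)))
          (trans (cong g (sym (φ-inside (old (double (suc (j ℕ.+ l))))
                                         (subst (_∈ᵇ S) (run l (ℕₚ.<⇒≤ l<a)) (inside l l<a)))))
            (trans (cong g (sym (zigzag-odd (suc (j ℕ.+ l)) φ g w))) (sym (zigzag-even (suc (j ℕ.+ l)) φ g w)))))
      new≡old : new (double (suc k)) ≡ old (double (suc (j ℕ.+ a)))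
      new≡old = begin
          new (double (suc k))
        ≡⟨ zigzag-even k β gˢ w ⟩
          gˢ (new (suc (double k)))
        ≡⟨ cong gˢ (zigzag-odd k β gˢ w) ⟩
          gˢ (β (new (double k)))
        ≡⟨ cong (λ q → gˢ (β q)) same ⟩
          gˢ (β (old (double j)))
        ≡⟨ cong gˢ (sym (φ-outside (old (double j)) j-out)) ⟩
          gˢ (φ (old (double j)))
        ≡⟨ cong gˢ (sym (zigzag-odd j φ g w)) ⟩
          gˢ v
        ≡⟨ gˢ≡ ⟩
          zigzag c g (double a) (g v)
        ≡⟨ run a ℕₚ.≤-refl ⟩
          old (double (suc (j ℕ.+ a)))
        ∎
        where open ≡-Reasoning

    new-on-old : ∀ k → Σ ℕ λ j → new (double k) ≡ old (double j)
    new-on-old zero    = zero , refl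
    new-on-old (suc k) =
      let (j , same) = new-on-old k
          (a , same′ , _) = next-exit k j same (subst (_∉ᵇ S) same (new-outside (double k)))
      in suc (j ℕ.+ a) , same′

    LastVisit : ℕ → Set
    LastVisit i = Σ ℕ λ j → j ≤ i × (Σ ℕ λ k → new (double k) ≡ old (double j)) × old (double j) ∉ᵇ S
                          × (∀ l → j < l → l ≤ i → old (double l) ∈ᵇ S)

    last-visit-exit : ∀ i j k → j ≤ i → new (double k) ≡ old (double j) → old (double j) ∉ᵇ S →
      (∀ l → j < l → l ≤ i → old (double l) ∈ᵇ S) → old (double (suc i)) ∉ᵇ S → LastVisit (suc i)
    last-visit-exit i j k j≤i same j-out between i-out with next-exit k j same j-out
    ... | a , same′ , inside , exit with ℕₚ.<-cmp (j ℕ.+ a) i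
    ... | tri≈ _ j+a≡i _ = suc i , ℕₚ.≤-refl
                          , (suc k , subst (λ q → new (double (suc k)) ≡ old (double (suc q))) j+a≡i same′)
                          , i-out , λ l lt le → ⊥-elim (ℕₚ.<⇒≱ lt le)
    ... | tri< j+a<i _ _ = ⊥-elim (false≢true (trans (sym exit) (between (suc (j ℕ.+ a)) (s≤s (ℕₚ.m≤m+n j a)) j+a<i)))
    ... | tri> _ _ i<j+a = ⊥-elim (false≢true (trans (sym i-out)
          (subst (λ q → old (double (suc q)) ∈ᵇ S) j+[i∸j]≡i
            (inside (i ∸ j) (ℕₚ.+-cancelˡ-< j (i ∸ j) a (subst (_< j ℕ.+ a) (sym j+[i∸j]≡i) i<j+a))))))
      where
      j+[i∸j]≡i : j ℕ.+ (i ∸ j) ≡ i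
      j+[i∸j]≡i = ℕₚ.m+[n∸m]≡n j≤i

    last-visit : ∀ i → LastVisit i
    last-visit zero =
      zero , z≤n , (zero , refl) , proj₂ (∈V′⁻ wV′) , λ { l lt z≤n → ⊥-elim (ℕₚ.<⇒≱ lt z≤n) }
    last-visit (suc i) with last-visit i | elem (old (double (suc i))) S in i-in?
    ... | j , j≤i , visit , j-out , between | true = j , ℕₚ.m≤n⇒m≤1+n j≤i , visit , j-out , between′
      where
      between′ : ∀ l → j < l → l ≤ suc i → old (double l) ∈ᵇ S
      between′ l lt le with ℕₚ.m≤n⇒m<n∨m≡n le
      ... | inj₁ l<si = between l lt (ℕₚ.≤-pred l<si)
      ... | inj₂ refl = i-in?
    ... | j , j≤i , (k , same) , j-out , between | false = last-visit-exit i j k j≤i same j-out between i-in?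

    old-outside-on-new : ∀ i → old (double i) ∉ᵇ S → Σ ℕ λ k → new (double k) ≡ old (double i)
    old-outside-on-new i i-out with last-visit i
    ... | j , j≤i , visit , _ , between with ℕₚ.m≤n⇒m<n∨m≡n j≤i
    ...   | inj₂ refl = visit
    ...   | inj₁ j<i  = ⊥-elim (false≢true (trans (sym i-out) (between i j<i ℕₚ.≤-refl)))

    new⇒old : ∀ {z} → Reachable β gˢ w z → Reachable φ g w z
    new⇒old (k , refl) with parity k
    ... | t , inj₁ refl = let (j , e) = new-on-old t in double j , sym e
    ... | t , inj₂ refl = let (j , e) = new-on-old t in suc (double j) ,
            trans (zigzag-odd j φ g w) (trans (φ-outside (old (double j)) (subst (_∉ᵇ S) e (new-outside (double t))))
              (trans (cong β (sym e)) (sym (zigzag-odd t β gˢ w))))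

    even-outside : ∀ t → old (suc (double t)) ∉ᵇ S → old (double t) ∉ᵇ S
    even-outside t odd-out = ¬-not (λ t-in → false≢true (trans (sym odd-out)
      (subst (_∈ᵇ S) (trans (sym (φ-inside (old (double t)) t-in)) (sym (zigzag-odd t φ g w)))
                     (S-closed _ (old-∈ (double t)) t-in))))

    old⇒new : ∀ {z} → Reachable φ g w z → z ∉ᵇ S → Reachable β gˢ w z
    old⇒new (k , refl) z-out with parity k
    ... | t , inj₁ refl = let (j , e) = old-outside-on-new t z-out in double j , e
    ... | t , inj₂ refl with old-outside-on-new t (even-outside t z-out)
    ...   | j , e = suc (double j) ,
            trans (zigzag-odd j β gˢ w)
              (trans (cong β e) (trans (sym (φ-outside (old (double t)) (even-outside t z-out))) (sym (zigzag-odd t φ g w))))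

  cyc-after-suppression : ∀ w → w ∈ V′ → SameElems (cyc V′ β gˢ w) (filterB outside (cyc V φ g w))
  cyc-after-suppression w wV′ y = ≡-by-true
    (λ m → let (yV′ , p) = New.elem-cyc⁻ {w} {y} m
               (yV , y-out) = ∈V′⁻ yV′
           in elem-filterB⁺ outside (cyc V φ g w) y
                (elem⇒∈ _ (Old.elem-cyc⁺ (Walks.wV w wV′) yV (Walks.new⇒old w wV′ p)))
                (cong not y-out))
    (λ m → let (y∈cyc , y-out) = elem-filterB⁻ outside (cyc V φ g w) y m
               (yV , p) = Old.elem-cyc⁻ {w} {y} (∈⇒elem y∈cyc)
               y∉S = trans (sym (not-involutive _)) (cong not y-out)
           in New.elem-cyc⁺ wV′ (∈V′⁺ yV y∉S) (Walks.old⇒new w wV′ p y∉S))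

  in-S : ℕ → Bool
  in-S z = elem z S

  κ : ℕ → List ℕ
  κ = cyc V φ g

  inner-cycle : ∀ w → w ∈ V → all in-S (κ w) ≡ true → SameElems (cyc V g c w) (κ w)
  inner-cycle w wV all-in y = trans (cyc-sameElems-swap g-match c-match wV y)
    (sym (cyc-sameElems-by-zigzag φ-match g-match c-match wV
           (λ k → proj₁ (Old.zigzag-agree c wV φ≡c k w Old.reach-refl)) y))
    where
    φ≡c : ∀ z → Reachable φ g w z → φ z ≡ c z
    φ≡c z p = φ-inside z (all-true⁻ in-S (κ w) all-in z (elem⇒∈ (κ w) (Old.elem-cyc⁺ wV (Old.reach-∈ wV p) p)))

  inner-cycle′ : ∀ w → w ∈ V → all in-S (cyc V g c w) ≡ true → SameElems (cyc V g c w) (κ w)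
  inner-cycle′ w wV all-in y = trans (cyc-sameElems-swap g-match c-match wV y)
    (cyc-sameElems-by-zigzag c-match g-match φ-match wV
      (λ k → proj₁ (CG.zigzag-agree φ wV c≡φ k w CG.reach-refl)) y)
    where
    module CG = Alternating V c g c-match g-match
    c≡φ : ∀ z → Reachable c g w z → c z ≡ φ z
    c≡φ z p = sym (φ-inside z (all-true⁻ in-S (cyc V g c w) all-in z
      (elem⇒∈ (cyc V g c w) (GC.elem-cyc⁺ wV (CG.reach-∈ wV p) (reach-swap V c g c-match g-match wV p)))))

  inner-test : ∀ w → w ∈ V →
    (isMin w (cyc V g c w) ∧ all in-S (cyc V g c w)) ≡ (isMin w (κ w) ∧ all in-S (κ w))
  inner-test w wV with all in-S (κ w) in all-in
  ... | true = cong₂ _∧_ (isMin-sameElems w {cyc V g c w} {κ w} same)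
                         (trans (all-sameElems in-S {cyc V g c w} {κ w} same) all-in)
    where
    same : SameElems (cyc V g c w) (κ w)
    same = inner-cycle w wV all-in
  ... | false with all in-S (cyc V g c w) in all-in′
  ...   | true  = ⊥-elim (false≢true (trans (sym all-in)
                    (trans (sym (all-sameElems in-S {cyc V g c w} {κ w} (inner-cycle′ w wV all-in′))) all-in′)))
  ...   | false = trans (∧-zeroʳ _) (sym (∧-zeroʳ _))

  leastOnCycle leastOutside leastOfInnerCycle representative : ℕ → Bool
  leastOnCycle w      = isMin w (κ w)
  leastOutside w      = outside w ∧ isMin w (filterB outside (κ w))
  leastOfInnerCycle w = in-S w ∧ isMin w (κ w) ∧ all in-S (κ w)
  representative w    = if in-S w then isMin w (κ w) ∧ all in-S (κ w) else isMin w (filterB outside (κ w))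

  #cycles-after-suppression : #cycles V′ β gˢ ≡ count leastOutside V
  #cycles-after-suppression =
    trans (cong length (filterB-filterB (λ w → isMin w (cyc V′ β gˢ w)) outside V)) (cong length (filterB-cong V same))
    where
    same : ∀ w → w ∈ V → (outside w ∧ isMin w (cyc V′ β gˢ w)) ≡ leastOutside w
    same w wV with in-S w in w-in
    ... | true  = refl
    ... | false = isMin-sameElems w {cyc V′ β gˢ w} {filterB outside (κ w)} (cyc-after-suppression w (∈V′⁺ wV w-in))

  #innerCycles≡ : #innerCycles V S g c ≡ count leastOfInnerCycle V
  #innerCycles≡ = cong length (filterB-cong V (λ w wV → cong (in-S w ∧_) (inner-test w wV)))

  count-representative-split : count representative V ≡ count leastOutside V ℕ.+ count leastOfInnerCycle V
  count-representative-split =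
    trans (count-split in-S representative V)
      (trans (ℕₚ.+-comm (count (λ x → in-S x ∧ representative x) V) (count (λ x → not (in-S x) ∧ representative x) V))
        (cong₂ ℕ._+_ (cong length (filterB-cong V (λ w _ → out-case w)))
                     (cong length (filterB-cong V (λ w _ → in-case w)))))
    where
    out-case : ∀ w → (not (in-S w) ∧ representative w) ≡ leastOutside w
    out-case w with in-S w
    ... | true  = refl
    ... | false = refl
    in-case : ∀ w → (in-S w ∧ representative w) ≡ leastOfInnerCycle w
    in-case w with in-S w
    ... | true  = refl
    ... | false = refl

  module Cycle (w : ℕ) (wV : w ∈ V) where

    K : List ℕ
    K = V ∩ κ w

    K-unique : Unique K
    K-unique = filterB-unique _ V V-unique

    ∈K⁻ : ∀ {z} → z ∈ K → z ∈ V × z ∈ᵇ κ w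
    ∈K⁻ = ∈-filterB⁻ _ V

    ∈K⁺ : ∀ z → z ∈ᵇ κ w → z ∈ K
    ∈K⁺ z m = ∈-filterB⁺ _ V (proj₁ (Old.elem-cyc⁻ {w} {z} m)) m

    κ≈K : SameElems (κ w) K
    κ≈K y = ≡-by-true (λ m → ∈⇒elem (∈K⁺ y m)) (λ m → proj₂ (∈K⁻ (elem⇒∈ {y} K m)))

    same-cycle : ∀ {z} → z ∈ K → SameElems (κ z) (κ w)
    same-cycle zK = Old.cyc-sameElems wV (proj₂ (∈K⁻ zK))

    one-least : count (λ z → isMin z (κ w)) K ≡ 1
    one-least = count-isMin K (κ w) K-unique κ≈K (∈K⁺ w (Old.elem-cyc-self wV))

    count-leastOnCycle : count leastOnCycle K ≡ 1
    count-leastOnCycle =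
      trans (cong length (filterB-cong K (λ z zK → isMin-sameElems z {κ z} {κ w} (same-cycle zK)))) one-least

    count-representative-inner : all in-S (κ w) ≡ true → count representative K ≡ 1
    count-representative-inner all-in = trans (cong length (filterB-cong K least)) one-least
      where
      least : ∀ z → z ∈ K → representative z ≡ isMin z (κ w)
      least z zK rewrite all-true⁻ in-S (κ w) all-in z (elem⇒∈ _ (proj₂ (∈K⁻ zK))) =
        trans (cong₂ _∧_ (isMin-sameElems z {κ z} {κ w} (same-cycle zK))
                         (trans (all-sameElems in-S {κ z} {κ w} (same-cycle zK)) all-in))
              (∧-identityʳ _)

    count-representative-outer : all in-S (κ w) ≡ false → count representative K ≡ 1
    count-representative-outer not-all-in with all-false⁻ in-S (κ w) not-all-in
    ... | z₀ , z₀∈κ , z₀-out =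
      trans (cong length (filterB-cong K least-outside))
        (trans (cong length (sym (filterB-filterB (λ z → isMin z κ-out) outside K)))
          (count-isMin (filterB outside K) κ-out (filterB-unique outside K K-unique)
             (filterB-sameElems outside {κ w} {K} κ≈K) z₀∈K-out))
      where
      κ-out : List ℕ
      κ-out = filterB outside (κ w)
      z₀∈K-out : z₀ ∈ filterB outside K
      z₀∈K-out = ∈-filterB⁺ outside K (∈K⁺ z₀ (∈⇒elem z₀∈κ)) (cong not z₀-out)
      least-outside : ∀ z → z ∈ K → representative z ≡ (outside z ∧ isMin z κ-out)
      least-outside z zK with in-S z
      ... | true  = trans (cong (isMin z (κ z) ∧_) (trans (all-sameElems in-S {κ z} {κ w} (same-cycle zK)) not-all-in))
                          (∧-zeroʳ _)
      ... | false = isMin-sameElems z {filterB outside (κ z)} {κ-out}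
                      (filterB-sameElems outside {κ z} {κ w} (same-cycle zK))

    count-representative : count representative K ≡ 1
    count-representative with all in-S (κ w) in all-in
    ... | true  = count-representative-inner all-in
    ... | false = count-representative-outer all-in

  -- Every (φ, g)-cycle either lies inside S, where it is a (g, c)-cycle that
  -- becomes an isolate, or its vertices outside S form one (β, gˢ)-cycle.
  #cycles-suppression : #cycles V′ β gˢ ℕ.+ #innerCycles V S g c ≡ #cycles V φ g
  #cycles-suppression =
    trans (cong₂ ℕ._+_ #cycles-after-suppression #innerCycles≡)
      (trans (sym count-representative-split)
        (sym (count-by-classes κ leastOnCycle representative V (λ w wV → Old.elem-cyc-self wV)
               (λ w z wV zV m → Old.cyc-sameElems wV m)
               (λ w wV → trans (Cycle.count-leastOnCycle w wV) (sym (Cycle.count-representative w wV))))))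

-- Faces after removing closed sets

piecewise-matching : ∀ {V T f₁ f₂} → IsMatching V f₁ → IsMatching V f₂ → Closed V T f₁ → Closed V T f₂ →
  IsMatching V (piecewise T f₁ f₂)
piecewise-matching {V} {T} {f₁} {f₂} m₁ m₂ c₁ c₂ x xV with elem x T in e
... | true  = proj₁ (m₁ x xV)
            , trans (cong (λ q → if q then f₁ (f₁ x) else f₂ (f₁ x)) (c₁ x xV e)) (proj₁ (proj₂ (m₁ x xV)))
            , proj₂ (proj₂ (m₁ x xV))
... | false = proj₁ (m₂ x xV)
            , trans (cong (λ q → if q then f₁ (f₂ x) else f₂ (f₂ x)) (closed-complement {V} {T} {f₂} m₂ c₂ x xV e))
                    (proj₁ (proj₂ (m₂ x xV)))
            , proj₂ (proj₂ (m₂ x xV))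

restrict-matching : ∀ {V T f} → IsMatching V f → Closed V T f → IsMatching (filterB (λ v → not (elem v T)) V) f
restrict-matching {V} {T} {f} f-match closed x x∈ with ∈-filterB⁻ (λ v → not (elem v T)) V x∈
... | xV , x-out = ∈-filterB⁺ (λ v → not (elem v T)) V (proj₁ (f-match x xV))
                     (cong not (closed-complement {V} {T} {f} f-match closed x xV
                                  (trans (sym (not-involutive _)) (cong not x-out))))
                 , proj₂ (f-match x xV)

Closed-⊆ : ∀ {V V₁ T f} → Closed V T f → (∀ {y} → y ∈ V₁ → y ∈ V) → Closed V₁ T f
Closed-⊆ closed sub y yV₁ m = closed y (sub yV₁) m

Closed-++ : ∀ {V T₁ T₂ f} → Closed V T₁ f → Closed V T₂ f → Closed V (T₁ ++ T₂) f
Closed-++ {V} {T₁} {T₂} {f} c₁ c₂ y yV m with ∨-true⁻ (elem y T₁) (trans (sym (elem-++ y T₁ T₂)) m)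
... | inj₁ p = trans (elem-++ (f y) T₁ T₂) (cong (_∨ elem (f y) T₂) (c₁ y yV p))
... | inj₂ p = trans (elem-++ (f y) T₁ T₂) (∨-trueʳ (elem (f y) T₁) (c₂ y yV p))

Closed-piecewise : ∀ {V T T′ f₁ f₂} → Closed V T f₁ → Closed V T f₂ → Closed V T (piecewise T′ f₁ f₂)
Closed-piecewise {T′ = T′} c₁ c₂ y yV m with elem y T′
... | true  = c₁ y yV m
... | false = c₂ y yV m

walk-cong : ∀ {f f′ h h′} → (∀ x → f x ≡ f′ x) → (∀ x → h x ≡ h′ x) →
  ∀ n w → walk f h n w ≡ walk f′ h′ n w
walk-cong ef eh zero    w = refl
walk-cong {f′ = f′} ef eh (suc n) w rewrite ef w = cong (w ∷_) (walk-cong eh ef n (f′ w))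

#cycles-cong : ∀ V {f f′ h h′} → (∀ x → f x ≡ f′ x) → (∀ x → h x ≡ h′ x) →
  #cycles V f h ≡ #cycles V f′ h′
#cycles-cong V ef eh = cong length (filterB-cong V (λ w _ →
  cong (λ W → isMin w (V ∩ W)) (walk-cong ef eh (length V) w)))

a+[i+n]≡m+i : ∀ {a n m} i → a ℕ.+ n ≡ m → a ℕ.+ (i ℕ.+ n) ≡ m ℕ.+ i
a+[i+n]≡m+i {a} {n} i refl = trans (cong (a ℕ.+_) (ℕₚ.+-comm i n)) (sym (ℕₚ.+-assoc a n i))

f-remove : ∀ H S c → Unique (verts H) → IsMatching (verts H) (g H) → IsMatching (verts H) c →
  IsMatching (verts H) (piecewise S c (b H)) → Closed (verts H) S c →
  f (remove H S c) ≡ #cycles (verts H) (piecewise S c (b H)) (g H) ℕ.+ isolates H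
f-remove H S c V-unique g-match c-match φ-match S-closed =
  a+[i+n]≡m+i {#cycles V′ (b H) gˢ} (isolates H) #cycles-suppression
  where open Suppression (verts H) V-unique S (g H) c (b H) g-match c-match φ-match S-closed

follow-cong : ∀ {S S′} → SameElems S S′ → ∀ g c n y → follow S g c n y ≡ follow S′ g c n y
follow-cong s g c zero    y = refl
follow-cong {S} {S′} s g c (suc n) y rewrite s y with elem y S′
... | true  = follow-cong s g c n (g (c y))
... | false = refl

all-cong : ∀ (p q : ℕ → Bool) L → (∀ y → p y ≡ q y) → all p L ≡ all q L
all-cong p q []      h = refl
all-cong p q (x ∷ L) h = cong₂ _∧_ (h x) (all-cong p q L h)

f-remove-sameElems : ∀ H c {S S′} → SameElems S S′ → f (remove H S c) ≡ f (remove H S′ c)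
f-remove-sameElems H c {S} {S′} s = cong₂ ℕ._+_ same-cycles (cong (isolates H ℕ.+_) same-inner)
  where
  V : List ℕ
  V = verts H
  g₁ g₂ : ℕ → ℕ
  g₁ x = follow S (g H) c (length V) (g H x)
  g₂ x = follow S′ (g H) c (length V) (g H x)
  same-cycles :
    #cycles (filterB (λ v → not (elem v S)) V) (b H) g₁ ≡ #cycles (filterB (λ v → not (elem v S′)) V) (b H) g₂
  same-cycles =
    trans (cong (λ L → #cycles L (b H) g₁) (filterB-cong V (λ v _ → cong not (s v))))
          (#cycles-cong (filterB (λ v → not (elem v S′)) V) {b H} {b H} {g₁} {g₂} (λ _ → refl)
                        (λ x → follow-cong s (g H) c (length V) (g H x)))
  same-inner : #innerCycles V S (g H) c ≡ #innerCycles V S′ (g H) c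
  same-inner = cong length (filterB-cong V (λ w _ → cong₂ _∧_ (s w)
                 (cong (isMin w (cyc V (g H) c w) ∧_) (all-cong _ _ (cyc V (g H) c w) s))))

f-remove-[] : ∀ H c → f (remove H [] c) ≡ f H
f-remove-[] H c = cong₂ ℕ._+_
  (trans (cong (λ L → #cycles L (b H) (λ x → follow [] (g H) c (length (verts H)) (g H x)))
               (filterB-all _ (verts H) (λ _ _ → refl)))
         (#cycles-cong (verts H) (λ _ → refl) (λ x → follow-[] (length (verts H)) (g H x))))
  (trans (cong (isolates H ℕ.+_) (count-≡0 _ (verts H) (λ _ _ → refl))) (ℕₚ.+-identityʳ (isolates H)))
  where
  follow-[] : ∀ n y → follow [] (g H) c n y ≡ y
  follow-[] zero    y = refl
  follow-[] (suc n) y = refl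

module Removal (H : Gehm) (H-gehm : IsGehm H) (e T : List ℕ)
               (e-b : Closed (verts H) e (b H)) (e-r : Closed (verts H) e (r H))
               (T-b : Closed (verts H) T (b H)) (T-r : Closed (verts H) T (r H)) where

  V : List ℕ
  V = verts H

  b-match : IsMatching V (b H)
  b-match = proj₁ (proj₂ H-gehm)

  g-match : IsMatching V (g H)
  g-match = proj₁ (proj₂ (proj₂ H-gehm))

  r-match : IsMatching V (r H)
  r-match = proj₂ (proj₂ (proj₂ H-gehm))

  φ : ℕ → ℕ
  φ = piecewise T (r H) (b H)

  φ-match : IsMatching V φ
  φ-match = piecewise-matching {V} {T} {r H} {b H} r-match b-match T-r T-b

  e-φ : Closed V e φ
  e-φ = Closed-piecewise {V} {e} {T} {r H} {b H} e-r e-b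

  f-remove-twice : ∀ c → IsMatching V c → Closed V e c →
    f (remove (remove H e c) T (r H)) ≡ #cycles V (piecewise e c φ) (g H) ℕ.+ isolates H
  f-remove-twice c c-match e-c =
    begin
      f (remove (remove H e c) T (r H))
    ≡⟨ f-remove (remove H e c) T (r H) (filterB-unique _ V (proj₁ H-gehm))
         (Suppression.gˢ-match V (proj₁ H-gehm) e (g H) c (b H) g-match c-match
            (piecewise-matching {V} {e} {c} {b H} c-match b-match e-c e-b) e-c)
         (restrict-matching {V} {e} {r H} r-match e-r) (restrict-matching {V} {e} {φ} φ-match e-φ)
         (Closed-⊆ {V} {_} {T} {r H} T-r (λ m → proj₁ (∈-filterB⁻ _ V m))) ⟩
      #cycles V₁ φ g₁ ℕ.+ (isolates H ℕ.+ #innerCycles V e (g H) c)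
    ≡⟨ a+[i+n]≡m+i {#cycles V₁ φ g₁} (isolates H)
         (Suppression.#cycles-suppression V (proj₁ H-gehm) e (g H) c φ g-match c-match
         (piecewise-matching {V} {e} {c} {φ} c-match φ-match e-c e-φ) e-c) ⟩
      #cycles V (piecewise e c φ) (g H) ℕ.+ isolates H
    ∎
    where
    open ≡-Reasoning
    V₁ : List ℕ
    V₁ = filterB (λ v → not (elem v e)) V
    g₁ : ℕ → ℕ
    g₁ x = follow e (g H) c (length V) (g H x)

  f-remove-deletion : f (remove (H ∖ e) T (r H)) ≡ f (remove H (e ++ T) (r H))
  f-remove-deletion =
    begin
      f (remove (H ∖ e) T (r H))
    ≡⟨ f-remove-twice (r H) r-match e-r ⟩
      #cycles V (piecewise e (r H) φ) (g H) ℕ.+ isolates H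
    ≡⟨ cong (ℕ._+ isolates H) (#cycles-cong V piecewise-++ (λ _ → refl)) ⟩
      #cycles V (piecewise (e ++ T) (r H) (b H)) (g H) ℕ.+ isolates H
    ≡⟨ sym (f-remove H (e ++ T) (r H) (proj₁ H-gehm) g-match r-match
         (piecewise-matching {V} {e ++ T} {r H} {b H} r-match b-match (Closed-++ {V} {e} {T} {r H} e-r T-r)
                             (Closed-++ {V} {e} {T} {b H} e-b T-b))
         (Closed-++ {V} {e} {T} {r H} e-r T-r)) ⟩
      f (remove H (e ++ T) (r H))
    ∎
    where
    open ≡-Reasoning
    piecewise-++ : ∀ x → piecewise e (r H) φ x ≡ piecewise (e ++ T) (r H) (b H) x
    piecewise-++ x rewrite elem-++ x e T with elem x e
    ... | true  = refl
    ... | false = refl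

  f-remove-contraction : (∀ y → y ∈ᵇ e → y ∉ᵇ T) → f (remove (H ／ e) T (r H)) ≡ f (remove H T (r H))
  f-remove-contraction disjoint =
    begin
      f (remove (H ／ e) T (r H))
    ≡⟨ f-remove-twice (b H) b-match e-b ⟩
      #cycles V (piecewise e (b H) φ) (g H) ℕ.+ isolates H
    ≡⟨ cong (ℕ._+ isolates H) (#cycles-cong V piecewise-disjoint (λ _ → refl)) ⟩
      #cycles V φ (g H) ℕ.+ isolates H
    ≡⟨ sym (f-remove H T (r H) (proj₁ H-gehm) g-match r-match φ-match T-r) ⟩
      f (remove H T (r H))
    ∎
    where
    open ≡-Reasoning
    piecewise-disjoint : ∀ x → piecewise e (b H) φ x ≡ φ x
    piecewise-disjoint x with elem x e in x∈e
    ... | true rewrite disjoint x x∈e = refl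
    ... | false = refl

-- Sums over subsets of hyperedges

-- The weight of a set A of hyperedges sees only d(A), |A| and the vertices of the hyperedges outside A.
Weight : Set
Weight = ℕ → ℕ → List ℕ → ℤ

weigh : Weight → List Hyperedge × List Hyperedge → ℤ
weigh G (A , C) = G (dSet A) (length A) (concat C)

subsetSum : List Hyperedge → Weight → ℤ
subsetSum L G = sumℤ (map (weigh G) (splits L))

inA inC : Hyperedge → Weight → Weight
inA x G a l S = G (d x ℕ.+ a) (suc l) S
inC x G a l S = G a l (x ++ S)

sumℤ-++ : ∀ (A B : List ℤ) → sumℤ (A ++ B) ≡ sumℤ A + sumℤ B
sumℤ-++ []      B = sym (ℤₚ.+-identityˡ _)
sumℤ-++ (x ∷ A) B = trans (cong (x +_) (sumℤ-++ A B)) (sym (ℤₚ.+-assoc x (sumℤ A) (sumℤ B)))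

subsetSum-∷ : ∀ x L G → subsetSum (x ∷ L) G ≡ subsetSum L (inA x G) + subsetSum L (inC x G)
subsetSum-∷ x L G =
  trans (cong sumℤ (Listₚ.map-++ (weigh G) (map addA (splits L)) (map addC (splits L))))
    (trans (sumℤ-++ (map (weigh G) (map addA (splits L))) (map (weigh G) (map addC (splits L))))
      (cong₂ _+_ (cong sumℤ (sym (Listₚ.map-∘ (splits L)))) (cong sumℤ (sym (Listₚ.map-∘ (splits L))))))
  where
  addA addC : List Hyperedge × List Hyperedge → List Hyperedge × List Hyperedge
  addA (A , C) = x ∷ A , C
  addC (A , C) = A , x ∷ C

subsetSum-cong : ∀ L G G′ →
  (∀ A C → A ⊆ L → C ⊆ L → G (dSet A) (length A) (concat C) ≡ G′ (dSet A) (length A) (concat C)) →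
  subsetSum L G ≡ subsetSum L G′
subsetSum-cong []      G G′ h = cong (_+ ℤ.+ 0) (h [] [] (λ ()) (λ ()))
subsetSum-cong (x ∷ L) G G′ h =
  trans (subsetSum-∷ x L G)
    (trans (cong₂ _+_
      (subsetSum-cong L (inA x G) (inA x G′) (λ A C A⊆L C⊆L → h (x ∷ A) C (∷-⊆ A⊆L) (λ m → there (C⊆L m))))
      (subsetSum-cong L (inC x G) (inC x G′) (λ A C A⊆L C⊆L → h A (x ∷ C) (λ m → there (A⊆L m)) (∷-⊆ C⊆L))))
    (sym (subsetSum-∷ x L G′)))
  where
  ∷-⊆ : ∀ {A} → A ⊆ L → x ∷ A ⊆ x ∷ L
  ∷-⊆ s (here refl) = here refl
  ∷-⊆ s (there m)   = there (s m)

subsetSum-cong-∀ : ∀ L G G′ → (∀ a l S → G a l S ≡ G′ a l S) → subsetSum L G ≡ subsetSum L G′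
subsetSum-cong-∀ L G G′ h = subsetSum-cong L G G′ (λ A C _ _ → h _ _ _)

subsetSum-* : ∀ L k G → subsetSum L (λ a l S → k * G a l S) ≡ k * subsetSum L G
subsetSum-* []      k G = trans (ℤₚ.+-identityʳ _) (cong (k *_) (sym (ℤₚ.+-identityʳ _)))
subsetSum-* (x ∷ L) k G =
  trans (subsetSum-∷ x L (λ a l S → k * G a l S))
    (trans (cong₂ _+_ (subsetSum-* L k (inA x G)) (subsetSum-* L k (inC x G)))
      (trans (sym (ℤₚ.*-distribˡ-+ k (subsetSum L (inA x G)) (subsetSum L (inC x G))))
             (cong (k *_) (sym (subsetSum-∷ x L G)))))

RespectsSameElems : Weight → Set
RespectsSameElems G = ∀ a l S S′ → SameElems S S′ → G a l S ≡ G a l S′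

SameElems-++ˡ : ∀ x {S S′} → SameElems S S′ → SameElems (x ++ S) (x ++ S′)
SameElems-++ˡ x {S} {S′} s y = trans (elem-++ y x S) (trans (cong (elem y x ∨_) (s y)) (sym (elem-++ y x S′)))

SameElems-++-swap : ∀ x e S → SameElems (x ++ (e ++ S)) (e ++ (x ++ S))
SameElems-++-swap x e S y rewrite elem-++ y x (e ++ S) | elem-++ y e S | elem-++ y e (x ++ S) | elem-++ y x S
  with elem y x | elem y e
... | true  | true  = refl
... | true  | false = refl
... | false | true  = refl
... | false | false = refl

-- Moving e to the front reorders the concatenated complements, hence the hypothesis on G.
subsetSum-pivot : ∀ xs e ys G → RespectsSameElems G →
  subsetSum (xs ++ e ∷ ys) G ≡ subsetSum (xs ++ ys) (inA e G) + subsetSum (xs ++ ys) (inC e G)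
subsetSum-pivot []       e ys G resp = subsetSum-∷ e ys G
subsetSum-pivot (x ∷ xs) e ys G resp =
  begin
    subsetSum (x ∷ (xs ++ e ∷ ys)) G
  ≡⟨ subsetSum-∷ x (xs ++ e ∷ ys) G ⟩
    subsetSum (xs ++ e ∷ ys) (inA x G) + subsetSum (xs ++ e ∷ ys) (inC x G)
  ≡⟨ cong₂ _+_ (subsetSum-pivot xs e ys (inA x G) (λ a l S S′ s → resp _ _ S S′ s))
               (subsetSum-pivot xs e ys (inC x G)
                  (λ a l S S′ s → resp a l (x ++ S) (x ++ S′) (SameElems-++ˡ x {S} {S′} s))) ⟩
    (ΣR (inA e (inA x G)) + ΣR (inC e (inA x G))) + (ΣR (inA e (inC x G)) + ΣR (inC e (inC x G)))
  ≡⟨ interchange (ΣR (inA e (inA x G))) (ΣR (inC e (inA x G))) (ΣR (inA e (inC x G))) (ΣR (inC e (inC x G))) ⟩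
    (ΣR (inA e (inA x G)) + ΣR (inA e (inC x G))) + (ΣR (inC e (inA x G)) + ΣR (inC e (inC x G)))
  ≡⟨ cong₂ _+_
       (cong (_+ ΣR (inA e (inC x G)))
             (subsetSum-cong-∀ R _ _ (λ a l S → cong (λ q → G q (suc (suc l)) S) (x∙yz≈y∙xz (d x) (d e) a))))
       (cong (ΣR (inC e (inA x G)) +_)
             (subsetSum-cong-∀ R _ _ (λ a l S → resp a l (x ++ (e ++ S)) (e ++ (x ++ S)) (SameElems-++-swap x e S)))) ⟩
    (ΣR (inA x (inA e G)) + ΣR (inC x (inA e G))) + (ΣR (inA x (inC e G)) + ΣR (inC x (inC e G)))
  ≡⟨ cong₂ _+_ (sym (subsetSum-∷ x R (inA e G))) (sym (subsetSum-∷ x R (inC e G))) ⟩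
    subsetSum (x ∷ R) (inA e G) + subsetSum (x ∷ R) (inC e G)
  ∎
  where
  open ≡-Reasoning
  R : List Hyperedge
  R = xs ++ ys
  ΣR : Weight → ℤ
  ΣR = subsetSum R

faceWeight : Gehm → ℤ → ℤ → Weight
faceWeight K u v a l S = u ^ (a ∸ l) * v ^ f (remove K S (r K))

faceWeight-respects : ∀ K u v → RespectsSameElems (faceWeight K u v)
faceWeight-respects K u v a l S S′ s = cong (λ q → u ^ (a ∸ l) * v ^ q) (f-remove-sameElems K (r K) {S} {S′} s)

Z-without-hyperedges : ∀ H → hyperedges H ≡ [] → ∀ u v → Z H u v ≡ v ^ f H
Z-without-hyperedges H E≡[] u v =
  trans (cong (λ L → subsetSum L (faceWeight H u v)) E≡[])
    (trans (ℤₚ.+-identityʳ _) (trans (ℤₚ.*-identityˡ _) (cong (v ^_) (f-remove-[] H (r H)))))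

[x+a]∸[1+l]≡[x∸1]+[a∸l] : ∀ x a l → 1 ≤ x → l ≤ a → (x ℕ.+ a) ∸ suc l ≡ (x ∸ 1) ℕ.+ (a ∸ l)
[x+a]∸[1+l]≡[x∸1]+[a∸l] (suc x) a l _ l≤a = ℕₚ.+-∸-assoc x l≤a

length≤dSet : ∀ A → (∀ x → x ∈ A → 1 ≤ d x) → length A ≤ dSet A
length≤dSet []      h = z≤n
length≤dSet (x ∷ A) h = ℕₚ.+-mono-≤ (h x (here refl)) (length≤dSet A (λ y m → h y (there m)))

-- Hyperedges

2≤length : ∀ (L : List ℕ) {y z} → y ∈ L → z ∈ L → y ≢ z → 2 ≤ length L
2≤length (a ∷ L)        (here refl) (here refl) y≢z = ⊥-elim (y≢z refl)
2≤length (a ∷ _ ∷ _)    (here refl) (there _)   y≢z = s≤s (s≤s z≤n)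
2≤length (a ∷ _ ∷ _)    (there _)   (here refl) y≢z = s≤s (s≤s z≤n)
2≤length (a ∷ L)        (there y∈L) (there z∈L) y≢z = ℕₚ.m≤n⇒m≤1+n (2≤length L y∈L z∈L y≢z)

Unique-++-∷⇒≢ : ∀ {w : ℕ} as bs → Unique (as ++ w ∷ bs) → ∀ {a} → a ∈ as ++ bs → a ≢ w
Unique-++-∷⇒≢ []       bs (w∉ ∷ u) a∈ a≡w = All.lookup w∉ a∈ (sym a≡w)
Unique-++-∷⇒≢ (a ∷ as) bs (a∉ ∷ u) (here refl) a≡w = All.lookup a∉ (∈ₚ.∈-++⁺ʳ as (here refl)) a≡w
Unique-++-∷⇒≢ (_ ∷ as) bs (_ ∷ u)  (there a∈) a≡w = Unique-++-∷⇒≢ as bs u a∈ a≡w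

Closed-concat : ∀ V f (C : List Hyperedge) → (∀ x → x ∈ C → Closed V x f) → Closed V (concat C) f
Closed-concat V f []      h y yV ()
Closed-concat V f (x ∷ C) h = Closed-++ {V} {x} {concat C} {f} (h x (here refl)) (Closed-concat V f C (λ z m → h z (there m)))

∉-concat : ∀ y (C : List Hyperedge) → (∀ x → x ∈ C → y ∉ᵇ x) → y ∉ᵇ concat C
∉-concat y []      h = refl
∉-concat y (x ∷ C) h rewrite elem-++ y x (concat C) | h x (here refl) = ∉-concat y C (λ z m → h z (there m))

module Hyperedges (H : Gehm) (H-gehm : IsGehm H) where

  V : List ℕ
  V = verts H

  V-unique : Unique V
  V-unique = proj₁ H-gehm

  b-match : IsMatching V (b H)
  b-match = proj₁ (proj₂ H-gehm)

  r-match : IsMatching V (r H)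
  r-match = proj₂ (proj₂ (proj₂ H-gehm))

  module BR = Alternating V (b H) (r H) b-match r-match

  κ : ℕ → List ℕ
  κ = cyc V (b H) (r H)

  leastOnHyperedge : ℕ → Bool
  leastOnHyperedge w = isMin w (κ w)

  W : List ℕ
  W = filterB leastOnHyperedge V

  ∈W⁻ : ∀ {a} → a ∈ W → a ∈ V × leastOnHyperedge a ≡ true
  ∈W⁻ = ∈-filterB⁻ leastOnHyperedge V

  κ-closed-b : ∀ w → w ∈ V → Closed V (κ w) (b H)
  κ-closed-b w wV y yV m = BR.elem-cyc⁺ wV (proj₁ (b-match y yV)) (BR.reach-f wV (proj₂ (BR.elem-cyc⁻ {w} {y} m)))

  κ-closed-r : ∀ w → w ∈ V → Closed V (κ w) (r H)
  κ-closed-r w wV y yV m = BR.elem-cyc⁺ wV (proj₁ (r-match y yV)) (BR.reach-h wV (proj₂ (BR.elem-cyc⁻ {w} {y} m)))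

  d-κ-positive : ∀ w → w ∈ V → 1 ≤ d (κ w)
  d-κ-positive w wV = m≥n⇒m/n>0 {length (κ w)} {2}
    (2≤length (κ w) (elem⇒∈ (κ w) (BR.elem-cyc-self wV))
                    (elem⇒∈ (κ w) (BR.elem-cyc⁺ wV (proj₁ (b-match w wV)) (BR.reach-f wV BR.reach-refl)))
                    (λ e → proj₂ (proj₂ (b-match w wV)) (sym e)))

  κ-meet : ∀ {w₀ w y} → w₀ ∈ V → w ∈ V → y ∈ᵇ κ w₀ → y ∈ᵇ κ w → w ∈ᵇ κ w₀
  κ-meet {w₀} {w} {y} w₀V wV y∈κw₀ y∈κw =
    trans (sym (BR.cyc-sameElems {w₀} {y} w₀V y∈κw₀ w))
          (trans (BR.cyc-sameElems {w} {y} wV y∈κw w) (BR.elem-cyc-self wV))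

  module Pivot (e : Hyperedge) (e∈E : e ∈ hyperedges H) where

    w₀ : ℕ
    w₀ = proj₁ (∈ₚ.∈-map⁻ κ e∈E)

    w₀∈W : w₀ ∈ W
    w₀∈W = proj₁ (proj₂ (∈ₚ.∈-map⁻ κ e∈E))

    e≡κw₀ : e ≡ κ w₀
    e≡κw₀ = proj₂ (proj₂ (∈ₚ.∈-map⁻ κ e∈E))

    w₀V : w₀ ∈ V
    w₀V = proj₁ (∈W⁻ w₀∈W)

    as bs : List ℕ
    as = proj₁ (∈ₚ.∈-∃++ w₀∈W)
    bs = proj₁ (proj₂ (∈ₚ.∈-∃++ w₀∈W))

    W≡ : W ≡ as ++ w₀ ∷ bs
    W≡ = proj₂ (proj₂ (∈ₚ.∈-∃++ w₀∈W))

    W-unique : Unique (as ++ w₀ ∷ bs)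
    W-unique = subst Unique W≡ (filterB-unique leastOnHyperedge V V-unique)

    e-b : Closed V e (b H)
    e-b = subst (λ q → Closed V q (b H)) (sym e≡κw₀) (κ-closed-b w₀ w₀V)

    e-r : Closed V e (r H)
    e-r = subst (λ q → Closed V q (r H)) (sym e≡κw₀) (κ-closed-r w₀ w₀V)

    d-e-positive : 1 ≤ d e
    d-e-positive = subst (λ q → 1 ≤ d q) (sym e≡κw₀) (d-κ-positive w₀ w₀V)

    e⊆κw₀ : ∀ y → y ∈ᵇ e → y ∈ᵇ κ w₀
    e⊆κw₀ y = subst (y ∈ᵇ_) e≡κw₀

    -- Two least vertices on one b-r cycle are equal.
    other-least-∉e : ∀ a → a ∈ W → a ≢ w₀ → a ∉ᵇ e
    other-least-∉e a a∈W a≢w₀ = ¬-not (λ a∈e → a≢w₀ (ℕₚ.≤-antisym (a≤w₀ a∈e) (w₀≤a a∈e)))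
      where
      a≤w₀ : a ∈ᵇ e → a ≤ w₀
      a≤w₀ a∈e = isMin⇒≤ a (κ a) w₀ (proj₂ (∈W⁻ a∈W))
        (elem⇒∈ (κ a) (trans (BR.cyc-sameElems {w₀} {a} w₀V (e⊆κw₀ a a∈e) w₀) (BR.elem-cyc-self w₀V)))
      w₀≤a : a ∈ᵇ e → w₀ ≤ a
      w₀≤a a∈e = isMin⇒≤ w₀ (κ w₀) a (proj₂ (∈W⁻ w₀∈W)) (elem⇒∈ (κ w₀) (e⊆κw₀ a a∈e))

    outside-e : ℕ → Bool
    outside-e v = not (elem v e)

    V₁ : List ℕ
    V₁ = filterB outside-e V

    module BR₁ = Alternating V₁ (b H) (r H) (restrict-matching {V} {e} {b H} b-match e-b)
                                            (restrict-matching {V} {e} {r H} r-match e-r)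

    κ₁ : ℕ → List ℕ
    κ₁ = cyc V₁ (b H) (r H)

    κ₁≡κ : ∀ w → w ∈ V₁ → κ₁ w ≡ κ w
    κ₁≡κ w wV₁ = trans (filterB-filterB _ outside-e V) (filterB-cong V same-walk)
      where
      wV : w ∈ V
      wV = proj₁ (∈-filterB⁻ outside-e V wV₁)
      w∉e : outside-e w ≡ true
      w∉e = proj₂ (∈-filterB⁻ outside-e V wV₁)
      same-walk : ∀ z → z ∈ V →
        (outside-e z ∧ elem z (walk (b H) (r H) (length V₁) w)) ≡ elem z (walk (b H) (r H) (length V) w)
      same-walk z zV = ≡-by-true
        (λ m → let (k , _ , eq) = elem-walk⁻ (length V₁) (b H) (r H) w z (proj₂ (∧-true⁻ {outside-e z} m))
               in BR.reach⇒elem-walk wV (k , eq))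
        (λ m → let (k , _ , eq) = elem-walk⁻ (length V) (b H) (r H) w z m
                   z∉e : z ∉ᵇ e
                   z∉e = ¬-not (λ z∈e → false≢true (trans (sym (cong not (subst (w ∈ᵇ_) (sym e≡κw₀)
                           (κ-meet {w₀} {w} {z} w₀V wV (e⊆κw₀ z z∈e) (BR.elem-cyc⁺ wV zV (k , eq)))))) w∉e))
               in ∧-true⁺ (cong not z∉e) (BR₁.reach⇒elem-walk wV₁ (k , eq)))

    E∖e≡ : hyperedges (H ∖ e) ≡ map κ (filterB outside-e W)
    E∖e≡ = trans (cong (map κ₁) least₁≡)
      (Listₚ.map-cong-local (All.tabulate (λ {a} m → κ₁≡κ a (∈V₁ m))))
      where
      ∈V₁ : ∀ {a} → a ∈ filterB outside-e W → a ∈ V₁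
      ∈V₁ m = let (a∈W , a∉e) = ∈-filterB⁻ outside-e W m in ∈-filterB⁺ outside-e V (proj₁ (∈W⁻ a∈W)) a∉e
      least₁≡ : filterB (λ w → isMin w (κ₁ w)) V₁ ≡ filterB outside-e W
      least₁≡ = trans (filterB-cong V₁ (λ w m → cong (isMin w) (κ₁≡κ w m)))
        (trans (filterB-filterB leastOnHyperedge outside-e V)
          (trans (filterB-cong V (λ w _ → ∧-comm (outside-e w) (leastOnHyperedge w)))
                 (sym (filterB-filterB outside-e leastOnHyperedge V))))

    W∖w₀≡ : filterB outside-e W ≡ as ++ bs
    W∖w₀≡ =
      trans (cong (filterB outside-e) W≡) (trans (filterB-++ outside-e as (w₀ ∷ bs))
        (trans (cong (filterB outside-e as ++_) (skip-w₀ bs))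
          (cong₂ _++_
            (filterB-all outside-e as (λ a m → cong not (other-least-∉e a (as⊆W m) (≢w₀ (∈ₚ.∈-++⁺ˡ m)))))
            (filterB-all outside-e bs (λ a m → cong not (other-least-∉e a (bs⊆W m) (≢w₀ (∈ₚ.∈-++⁺ʳ as m))))))))
      where
      skip-w₀ : ∀ L → filterB outside-e (w₀ ∷ L) ≡ filterB outside-e L
      skip-w₀ L rewrite subst (w₀ ∈ᵇ_) (sym e≡κw₀) (BR.elem-cyc-self w₀V) = refl
      as⊆W : ∀ {a} → a ∈ as → a ∈ W
      as⊆W m = subst (_ ∈_) (sym W≡) (∈ₚ.∈-++⁺ˡ m)
      bs⊆W : ∀ {a} → a ∈ bs → a ∈ W
      bs⊆W m = subst (_ ∈_) (sym W≡) (∈ₚ.∈-++⁺ʳ as (there m))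
      ≢w₀ : ∀ {a} → a ∈ as ++ bs → a ≢ w₀
      ≢w₀ = Unique-++-∷⇒≢ as bs W-unique

    R : List Hyperedge
    R = map κ as ++ map κ bs

    E≡ : hyperedges H ≡ map κ as ++ e ∷ map κ bs
    E≡ = trans (cong (map κ) W≡)
               (trans (Listₚ.map-++ κ as (w₀ ∷ bs)) (cong (λ q → map κ as ++ q ∷ map κ bs) (sym e≡κw₀)))

    E∖e≡R : hyperedges (H ∖ e) ≡ R
    E∖e≡R = trans E∖e≡ (trans (cong (map κ) W∖w₀≡) (Listₚ.map-++ κ as bs))

    ∈R⁻ : ∀ {x} → x ∈ R → Σ ℕ λ a → a ∈ V × x ≡ κ a × a ∉ᵇ e
    ∈R⁻ {x} m with ∈ₚ.∈-map⁻ κ (subst (x ∈_) (sym (Listₚ.map-++ κ as bs)) m)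
    ... | a , a∈ , x≡ = a , proj₁ (∈W⁻ a∈W) , x≡ , other-least-∉e a a∈W (Unique-++-∷⇒≢ as bs W-unique a∈)
      where
      a∈W : a ∈ W
      a∈W = subst (_ ∈_) (sym W≡)
                  ([ ∈ₚ.∈-++⁺ˡ , (λ q → ∈ₚ.∈-++⁺ʳ as (there q)) ] (∈ₚ.∈-++⁻ as a∈))

    Closed-concat-R : ∀ c → (∀ a → a ∈ V → Closed V (κ a) c) → ∀ C → C ⊆ R → Closed V (concat C) c
    Closed-concat-R c κ-closed C C⊆R = Closed-concat V c C (λ x m →
      let (a , aV , x≡ , _) = ∈R⁻ (C⊆R m) in subst (λ q → Closed V q c) (sym x≡) (κ-closed a aV))

    e∉concat-R : ∀ C → C ⊆ R → ∀ y → y ∈ᵇ e → y ∉ᵇ concat C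
    e∉concat-R C C⊆R y y∈e = ∉-concat y C (λ x m →
      let (a , aV , x≡ , a∉e) = ∈R⁻ (C⊆R m)
      in subst (y ∉ᵇ_) (sym x≡) (¬-not (λ y∈κa → false≢true (trans (sym a∉e)
           (subst (a ∈ᵇ_) (sym e≡κw₀) (κ-meet {w₀} {a} {y} w₀V aV (e⊆κw₀ y y∈e) y∈κa))))))

    without-e : ∀ u v → subsetSum R (inC e (faceWeight H u v)) ≡ subsetSum R (faceWeight (H ∖ e) u v)
    without-e u v = subsetSum-cong R (inC e (faceWeight H u v)) (faceWeight (H ∖ e) u v)
      (λ A C _ C⊆R → cong (λ q → u ^ (dSet A ∸ length A) * v ^ q)
      (sym (Removal.f-remove-deletion H H-gehm e (concat C) e-b e-r
             (Closed-concat-R (b H) κ-closed-b C C⊆R) (Closed-concat-R (r H) κ-closed-r C C⊆R))))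

    with-e : ∀ u v → subsetSum R (inA e (faceWeight H u v)) ≡ u ^ (d e ∸ 1) * subsetSum R (faceWeight (H ／ e) u v)
    with-e u v =
      trans (subsetSum-cong R (inA e (faceWeight H u v)) (λ a l S → k * faceWeight (H ／ e) u v a l S) split)
            (subsetSum-* R k (faceWeight (H ／ e) u v))
      where
      k : ℤ
      k = u ^ (d e ∸ 1)
      split : ∀ A C → A ⊆ R → C ⊆ R →
        inA e (faceWeight H u v) (dSet A) (length A) (concat C) ≡ k * faceWeight (H ／ e) u v (dSet A) (length A) (concat C)
      split A C A⊆R C⊆R =
        begin
          u ^ ((d e ℕ.+ dSet A) ∸ suc (length A)) * v ^ f (remove H (concat C) (r H))
        ≡⟨ cong (λ q → u ^ q * v ^ f (remove H (concat C) (r H)))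
                ([x+a]∸[1+l]≡[x∸1]+[a∸l] (d e) (dSet A) (length A) d-e-positive (length≤dSet A d-A-positive)) ⟩
          u ^ ((d e ∸ 1) ℕ.+ (dSet A ∸ length A)) * v ^ f (remove H (concat C) (r H))
        ≡⟨ cong (_* v ^ f (remove H (concat C) (r H))) (ℤₚ.^-distribˡ-+-* u (d e ∸ 1) (dSet A ∸ length A)) ⟩
          k * u ^ (dSet A ∸ length A) * v ^ f (remove H (concat C) (r H))
        ≡⟨ ℤₚ.*-assoc k (u ^ (dSet A ∸ length A)) (v ^ f (remove H (concat C) (r H))) ⟩
          k * (u ^ (dSet A ∸ length A) * v ^ f (remove H (concat C) (r H)))
        ≡⟨ cong (λ q → k * (u ^ (dSet A ∸ length A) * v ^ q))
                (sym (Removal.f-remove-contraction H H-gehm e (concat C) e-b e-r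
                        (Closed-concat-R (b H) κ-closed-b C C⊆R) (Closed-concat-R (r H) κ-closed-r C C⊆R)
                        (e∉concat-R C C⊆R))) ⟩
          k * (u ^ (dSet A ∸ length A) * v ^ f (remove (H ／ e) (concat C) (r H)))
        ∎
        where
        open ≡-Reasoning
        d-A-positive : ∀ x → x ∈ A → 1 ≤ d x
        d-A-positive x m = let (a , aV , x≡ , _) = ∈R⁻ (A⊆R m) in subst (λ q → 1 ≤ d q) (sym x≡) (d-κ-positive a aV)

  Z-deletion-contraction : ∀ e → e ∈ hyperedges H → ∀ u v →
    Z H u v ≡ Z (H ∖ e) u v + u ^ (d e ∸ 1) * Z (H ／ e) u v
  Z-deletion-contraction e e∈E u v =
    begin
      Z H u v
    ≡⟨ cong (λ L → subsetSum L G) E≡ ⟩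
      subsetSum (map κ as ++ e ∷ map κ bs) G
    ≡⟨ subsetSum-pivot (map κ as) e (map κ bs) G (faceWeight-respects H u v) ⟩
      subsetSum R (inA e G) + subsetSum R (inC e G)
    ≡⟨ ℤₚ.+-comm (subsetSum R (inA e G)) (subsetSum R (inC e G)) ⟩
      subsetSum R (inC e G) + subsetSum R (inA e G)
    ≡⟨ cong₂ _+_ (without-e u v) (with-e u v) ⟩
      subsetSum R (faceWeight (H ∖ e) u v) + u ^ (d e ∸ 1) * subsetSum R (faceWeight (H ／ e) u v)
    ≡⟨ cong (λ L → subsetSum L (faceWeight (H ∖ e) u v) + u ^ (d e ∸ 1) * subsetSum L (faceWeight (H ／ e) u v))
            (sym E∖e≡R) ⟩
      Z (H ∖ e) u v + u ^ (d e ∸ 1) * Z (H ／ e) u v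
    ∎
    where
    open ≡-Reasoning
    open Pivot e e∈E
    G : Weight
    G = faceWeight H u v

corollary1 : (H : Gehm) → IsGehm H →
    (hyperedges H ≡ [] → (u v : ℤ) → Z H u v ≡ v ^ f H)
    × ((e : Hyperedge) → e ∈ hyperedges H → (u v : ℤ) →
    Z H u v ≡ Z (H ∖ e) u v + u ^ (d e ∸ 1) * Z (H ／ e) u v)
corollary1 H H-gehm = Z-without-hyperedges H , Hyperedges.Z-deletion-contraction H H-gehm
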